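{- Let $p\ge5$ be a prime and let $S_{p+1,2}=\{z\in[0,p-1]^2: z_1+z_2<p+1\}$ (sum in $\mathbb{Z}$), viewed as a subset of $\mathbb{F}_p^2$. Then any collection of affine lines in $\mathbb{F}_p^2$, none of which contains the origin $0^2$, whose union contains $S_{p+1,2}\setminus\{0^2\}$, consists of at least $p+1$ lines.
   Context: $\mathbb{F}_p$ is identified with $\{0,\ldots,p-1\}$. -}

module Defs where

open import Data.Nat using (ℕ; zero; suc; _+_; _*_; _<_; NonZero)
open import Data.Nat.DivMod using (_%_)
open import Data.Fin using (Fin; toℕ) renaming (zero to fzero)
open import Data.Product using (_×_; _,_; proj₁; proj₂; ∃)
open import Data.List using (List)
open import Data.List.Relation.Unary.Any using (Any)
open import Relation.Binary.PropositionalEquality using (_≡_)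
open import Relation.Nullary using (¬_)

-- 𝔽_p is identified with {0,…,p-1} = Fin p; arithmetic is mod p.
-- A point of 𝔽_p² is a pair of elements of Fin p.
Point : ℕ → Set
Point p = Fin p × Fin p

origin : ∀ {p} .{{_ : NonZero p}} → Point p
origin {suc n} = fzero , fzero

-- An affine line in 𝔽_p²: the solution set of  a·x + b·y = c  over 𝔽_p,
-- with (a , b) ≠ (0 , 0).
record Line (p : ℕ) : Set where
  constructor line
  field
    a b c   : Fin p
    nondeg  : ¬ (toℕ a ≡ 0 × toℕ b ≡ 0)

_∈L_ : ∀ {p} .{{_ : NonZero p}} → Point p → Line p → Set
_∈L_ {p} (x , y) L = (toℕ a * toℕ x + toℕ b * toℕ y) % p ≡ toℕ c
  where open Line L

InS∖0 : ∀ {p} → Point p → Set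
InS∖0 {p} (x , y) = (toℕ x + toℕ y < p + 1) × ¬ (toℕ x ≡ 0 × toℕ y ≡ 0)

-- Suppose at most p lines avoiding the origin cover S∖0.  The p - 1 points of S∖0 on
-- y = 0 are missed by every horizontal line of the cover and met at most once by every
-- other line, while y = 1 carries p points of S∖0; counting both forces every horizontal
-- line of the cover to be y = 1.  Likewise vertical lines are x = 1 and lines parallel to
-- x + y = 0 are x + y = -1.  Every other ("generic") line ℓ contains at most (p + 3)/2
-- points of S∖0: along ℓ the values x, y and (x + y) mod p each run through 𝔽_p once, so
-- x + y ≥ p at exactly (p - 1)/2 of its points, and x + y = p at most once.  Finally, for
-- a set Z of one or three suitable test lines containing the special lines present, every
-- generic line meets Z in a known number of points of S∖0, and counting the points of
-- S∖0 outside Z (there are (p² + 3p - 4)/2 points in S∖0) leaves too many for the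
-- generic lines, whatever subset of the three special lines occurs.

module Submission where

open import Data.Nat.Properties
open import Algebra.Properties.Semiring.Sum +-*-semiring
  using (sum; sum-syntax; sum-cong-≗; ∑-comm; ∑-distrib-+; *-distribˡ-sum)
open import Data.Bool.Base using (Bool; true; false; T; _∧_; _∨_; not)
open import Data.Bool.Properties using (∧-comm; ∧-assoc)
open import Data.Empty using (⊥; ⊥-elim)
open import Data.Fin.Base using (Fin; zero; suc; punchOut; toℕ; fromℕ<)
import Data.Fin.Properties as Fin
open import Data.Integer.Base as ℤ using (ℤ)
open import Data.Integer.Divisibility.Signed
  using (_∣_; divides; _∣?_; ∣⇒∣ᵤ; ∣ᵤ⇒∣; ∣m∣n⇒∣m+n; ∣m∣n⇒∣m-n; ∣m⇒∣-m; ∣n⇒∣m*n; ∣m⇒∣m*n)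
import Data.Integer.Properties as ℤ
import Data.Integer.Tactic.RingSolver as ℤ-Solver
open import Data.List.Base using (List; []; _∷_; length)
open import Data.List.Relation.Unary.All using (All; []; _∷_)
import Data.List.Relation.Unary.All as All
open import Data.List.Relation.Unary.All.Properties using (¬Any⇒All¬)
open import Data.List.Relation.Unary.Any using (Any; here; there; any?)
import Data.List.Relation.Unary.Any as Any
open import Data.Nat.Base using (ℕ; zero; suc; _+_; _*_; _∸_; _<_; _≤_; z≤n; s≤s; s≤s⁻¹; z<s; NonZero; >-nonZero; >-nonZero⁻¹; _%_; _/_)
open import Data.Nat.DivMod using (m≡m%n+[m/n]*n; [m+kn]%n≡m%n; [m+n]%n≡m%n; m<n⇒m%n≡m; m%n<n; n%n≡0)
import Data.Nat.Divisibility as ℕ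
open import Data.Nat.Primality using (Prime; euclidsLemma)
open import Data.Nat.Tactic.RingSolver using (solve-∀)
open import Data.Product using (_×_; _,_; proj₁; proj₂; ∃; swap)
open import Data.Sum using (_⊎_; inj₁; inj₂; [_,_]′)
import Data.Sum as Sum
open import Function.Base using (_∘_; id; case_of_)
open import Function.Bundles using (_⇔_; mk⇔; Equivalence)
open import Function.Definitions using (Injective)
open import Relation.Binary.PropositionalEquality
open import Relation.Nullary using (¬_; Dec; yes; no; contradiction; ¬?)
open import Relation.Nullary.Decidable using (⌊_⌋; toWitness; fromWitness; map′; _×-dec_; T?)

open import Defs

private
  variable
    m n : ℕ

χ : Bool → ℕ
χ true  = 1
χ false = 0

χ-∧ : ∀ a b → χ (a ∧ b) ≡ χ a * χ b
χ-∧ false b = refl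
χ-∧ true  b = sym (+-identityʳ (χ b))

χ-T : ∀ {b} → T b → χ b ≡ 1
χ-T {true} _ = refl

χ-F : ∀ {b} → ¬ T b → χ b ≡ 0
χ-F {true}  ¬b = contradiction _ ¬b
χ-F {false} _  = refl

χ-⊎ : ∀ a b c → (T a → T b ⊎ T c) → χ a ≤ χ b + χ c
χ-⊎ false _     _     _   = z≤n
χ-⊎ true  true  _     _   = s≤s z≤n
χ-⊎ true  false true  _   = s≤s z≤n
χ-⊎ true  false false a⇒ with a⇒ _
... | inj₁ ()
... | inj₂ ()

⌊⌋-cong : ∀ {A B : Set} (a? : Dec A) (b? : Dec B) → (A → B) → (B → A) → ⌊ a? ⌋ ≡ ⌊ b? ⌋
⌊⌋-cong (yes _) (yes _) _   _   = refl
⌊⌋-cong (no  _) (no  _) _   _   = refl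
⌊⌋-cong (yes a) (no ¬b) a⇒b _   = contradiction (a⇒b a) ¬b
⌊⌋-cong (no ¬a) (yes b) _   b⇒a = contradiction (b⇒a b) ¬a

T-∧ˡ : ∀ a {b} → T (a ∧ b) → T a
T-∧ˡ true _ = _

T-∧ʳ : ∀ a {b} → T (a ∧ b) → T b
T-∧ʳ true h = h

T-∧-intro : ∀ {a b} → T a → T b → T (a ∧ b)
T-∧-intro {true} _ h = h

T-∧₃ : ∀ a b c → T (a ∧ b ∧ c) → T a × T b × T c
T-∧₃ true true true _ = _ , _ , _

T-∨-introˡ : ∀ a {b} → T a → T (a ∨ b)
T-∨-introˡ true _ = _

T-∨-introʳ : ∀ a {b} → T b → T (a ∨ b)
T-∨-introʳ true  _  = _
T-∨-introʳ false Tb = Tb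

T-∧-not : ∀ a b → ¬ T (a ∧ not b) → T a → T b
T-∧-not true true  _  _ = _
T-∧-not true false ¬h _ = ¬h _

T-not⇒¬T : ∀ a → T (not a) → ¬ T a
T-not⇒¬T true  () _
T-not⇒¬T false _  ()

≡true⇒T : ∀ {b} → b ≡ true → T b
≡true⇒T refl = _

∑-mono-≤ : {f g : Fin n → ℕ} → (∀ i → f i ≤ g i) → sum f ≤ sum g
∑-mono-≤ {zero}  _ = z≤n
∑-mono-≤ {suc n} f≤g = +-mono-≤ (f≤g zero) (∑-mono-≤ (f≤g ∘ suc))

∑-zero : {f : Fin n → ℕ} → (∀ i → f i ≡ 0) → sum f ≡ 0
∑-zero {zero}  _ = refl
∑-zero {suc n} f≡0 = cong₂ _+_ (f≡0 zero) (∑-zero (f≡0 ∘ suc))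

∑-const : ∀ n k → ∑[ i < n ] k ≡ n * k
∑-const zero    k = refl
∑-const (suc n) k = cong (k +_) (∑-const n k)

∑-*ˡ : ∀ k (f : Fin n → ℕ) → ∑[ i < n ] (k * f i) ≡ k * sum f
∑-*ˡ k f = sym (*-distribˡ-sum k f)

term≤∑ : (f : Fin n → ℕ) (i : Fin n) → f i ≤ sum f
term≤∑ f zero    = m≤m+n _ _
term≤∑ f (suc i) = ≤-trans (term≤∑ (f ∘ suc) i) (m≤n+m _ _)

∑-unique : (P : Fin n → Bool) (g : Fin n → ℕ) {j : Fin n} →
           T (P j) → (∀ i → T (P i) → i ≡ j) → ∑[ i < n ] (χ (P i) * g i) ≡ g j
∑-unique P g {zero} Pj unique = trans
  (cong₂ _+_ (cong (_* g zero) (χ-T Pj)) (∑-zero λ i → cong (_* g (suc i)) (χ-F λ Pi → Fin.0≢1+n (sym (unique (suc i) Pi)))))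
  (trans (+-identityʳ _) (*-identityˡ (g zero)))
∑-unique P g {suc j} Pj unique = cong₂ _+_
  (cong (_* g zero) (χ-F λ P0 → Fin.0≢1+n (unique zero P0)))
  (∑-unique (P ∘ suc) (g ∘ suc) Pj λ i Pi → Fin.suc-injective (unique (suc i) Pi))

count-all : (P : Fin n → Bool) → (∀ i → T (P i)) → ∑[ i < n ] χ (P i) ≡ n
count-all {zero}  P all = refl
count-all {suc n} P all = cong₂ _+_ (χ-T (all zero)) (count-all (P ∘ suc) (all ∘ suc))

count-nonzero : .{{_ : NonZero n}} (P : Fin n → Bool) → (∀ i → toℕ i ≡ 0 → ¬ T (P i)) → (∀ i → toℕ i ≢ 0 → T (P i)) →
  suc (∑[ i < n ] χ (P i)) ≡ n
count-nonzero {suc n} P ¬P0 P≢0 = cong suc (cong₂ _+_ (χ-F (¬P0 zero refl)) (count-all (P ∘ suc) λ i → P≢0 (suc i) λ ()))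

count-zero : .{{_ : NonZero n}} → ∑[ i < n ] χ ⌊ toℕ i ≟ 0 ⌋ ≡ 1
count-zero {suc n} = cong suc (∑-zero {n} λ i → refl)

count-atMostOne : (P : Fin n → Bool) → (∀ i j → T (P i) → T (P j) → i ≡ j) → ∑[ i < n ] χ (P i) ≤ 1
count-atMostOne {zero}  P unique = z≤n
count-atMostOne {suc n} P unique with P zero in P0
... | true  = ≤-reflexive (cong suc (∑-zero {n} λ i → χ-F λ Pi → Fin.0≢1+n (unique zero (suc i) (subst T (sym P0) _) Pi)))
... | false = count-atMostOne (P ∘ suc) λ i j Pi Pj → Fin.suc-injective (unique (suc i) (suc j) Pi Pj)

count-≤ : ∀ k → k < n → ∑[ i < n ] χ ⌊ toℕ i ≤? k ⌋ ≡ suc k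
count-≤ {suc n} zero    _         = cong suc (∑-zero {n} λ i → refl)
count-≤ {suc n} (suc k) (s≤s k<n) = cong suc (trans (sum-cong-≗ {n} {λ i → χ ⌊ suc (toℕ i) ≤? suc k ⌋} {λ i → χ ⌊ toℕ i ≤? k ⌋} λ i → cong χ (≤?-suc (toℕ i) k)) (count-≤ k k<n))
  where
  ≤?-suc : ∀ m k → ⌊ suc m ≤? suc k ⌋ ≡ ⌊ m ≤? k ⌋
  ≤?-suc m k with m ≤? k | suc m ≤? suc k
  ... | yes _   | yes _     = refl
  ... | no  _   | no  _     = refl
  ... | yes m≤k | no  1+m≰  = contradiction (s≤s m≤k) 1+m≰
  ... | no  m≰k | yes 1+m≤  = contradiction (s≤s⁻¹ 1+m≤) m≰k

∑-toℕ : ∀ n → 2 * ∑[ i < n ] toℕ i + n ≡ n * n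
∑-toℕ zero    = refl
∑-toℕ (suc n) = begin
  2 * ∑[ i < n ] suc (toℕ i) + suc n ≡⟨ cong (λ s → 2 * s + suc n) (∑-distrib-+ (λ _ → 1) (toℕ {n})) ⟩
  2 * (∑[ i < n ] 1 + Σ) + suc n     ≡⟨ cong (λ s → 2 * (s + Σ) + suc n) (∑-const n 1) ⟩
  2 * (n * 1 + Σ) + suc n            ≡⟨ regroup n Σ ⟩
  (2 * Σ + n) + (2 * n + 1)          ≡⟨ cong (_+ (2 * n + 1)) (∑-toℕ n) ⟩
  n * n + (2 * n + 1)                ≡⟨ square n ⟩
  suc n * suc n                      ∎
  where
  open ≡-Reasoning
  Σ = ∑[ i < n ] toℕ i
  regroup : ∀ n t → 2 * (n * 1 + t) + suc n ≡ (2 * t + n) + (2 * n + 1)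
  regroup = solve-∀
  square : ∀ n → n * n + (2 * n + 1) ≡ suc n * suc n
  square = solve-∀

injective⇒surjective : {f : Fin n → Fin n} → Injective _≡_ _≡_ f → ∀ j → ∃ λ i → f i ≡ j
injective⇒surjective {suc n} {f} f-inj j with Fin.any? (λ i → f i Fin.≟ j)
... | yes hit  = hit
... | no  miss = contradiction (Fin.injective⇒≤ g-inj) 1+n≰n
  where
  g : Fin (suc n) → Fin n
  g i = punchOut {i = j} λ j≡fi → miss (i , sym j≡fi)
  g-inj : Injective _≡_ _≡_ g
  g-inj = f-inj ∘ Fin.punchOut-injective {i = j} _ _

∑-reindex : {f : Fin n → Fin n} → Injective _≡_ _≡_ f →
            (g : Fin n → ℕ) → ∑[ i < n ] g (f i) ≡ sum g
∑-reindex {n} {f} f-inj g = begin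
  ∑[ i < n ] g (f i)                                  ≡⟨ sum-cong-≗ (λ i → sym (∑-unique (hits i) g (fromWitness refl) λ j h → sym (toWitness h))) ⟩
  ∑[ i < n ] ∑[ j < n ] (χ (hits i j) * g j)          ≡⟨ ∑-comm (λ i j → χ (hits i j) * g j) ⟩
  ∑[ j < n ] ∑[ i < n ] (χ (hits i j) * g j)          ≡⟨ sum-cong-≗ fibre ⟩
  sum g                                               ∎
  where
  open ≡-Reasoning
  hits : Fin n → Fin n → Bool
  hits i j = ⌊ f i Fin.≟ j ⌋
  fibre : ∀ j → ∑[ i < n ] (χ (hits i j) * g j) ≡ g j
  fibre j with i₀ , fi₀≡j ← injective⇒surjective f-inj j =
    ∑-unique (λ i → hits i j) (λ _ → g j) (fromWitness fi₀≡j) λ i h → f-inj (trans (toWitness h) (sym fi₀≡j))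

∑² : (Fin m × Fin n → ℕ) → ℕ
∑² {m} {n} f = ∑[ x < m ] ∑[ y < n ] f (x , y)

∑²-mono-≤ : {f g : Fin m × Fin n → ℕ} → (∀ z → f z ≤ g z) → ∑² f ≤ ∑² g
∑²-mono-≤ f≤g = ∑-mono-≤ λ x → ∑-mono-≤ λ y → f≤g (x , y)

∑²-cong : {f g : Fin m × Fin n → ℕ} → (∀ z → f z ≡ g z) → ∑² f ≡ ∑² g
∑²-cong f≡g = sum-cong-≗ λ x → sum-cong-≗ λ y → f≡g (x , y)

∑²-distrib-+ : (f g : Fin m × Fin n → ℕ) → ∑² (λ z → f z + g z) ≡ ∑² f + ∑² g
∑²-distrib-+ {m} {n} f g = trans (sum-cong-≗ λ x → ∑-distrib-+ (λ y → f (x , y)) (λ y → g (x , y)))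
  (∑-distrib-+ (λ x → ∑[ y < n ] f (x , y)) (λ x → ∑[ y < n ] g (x , y)))

∑²-distrib-+₃ : (f g h : Fin m × Fin n → ℕ) → ∑² (λ z → f z + g z + h z) ≡ ∑² f + ∑² g + ∑² h
∑²-distrib-+₃ f g h = trans (∑²-distrib-+ (λ z → f z + g z) h) (cong (_+ ∑² h) (∑²-distrib-+ f g))

term≤∑² : (f : Fin m × Fin n → ℕ) (z : Fin m × Fin n) → f z ≤ ∑² f
term≤∑² f (x , y) = ≤-trans (term≤∑ (λ y → f (x , y)) y) (term≤∑ (λ x → ∑[ y < _ ] f (x , y)) x)

infixr 6 _∩_ _∖_
infixr 5 _∪_

_∩_ _∪_ _∖_ : {A : Set} → (A → Bool) → (A → Bool) → A → Bool
(P ∩ Q) z = P z ∧ Q z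
(P ∪ Q) z = P z ∨ Q z
(P ∖ Q) z = P z ∧ not (Q z)

#_ : (Fin m × Fin n → Bool) → ℕ
# P = ∑² (χ ∘ P)

#-transpose : (P : Fin m × Fin n → Bool) (Q : Fin n × Fin m → Bool) → (∀ z → P z ≡ Q (swap z)) → ∑² (χ ∘ P) ≡ ∑² (χ ∘ Q)
#-transpose P Q P≡Q = trans (∑-comm λ x y → χ (P (x , y))) (∑²-cong λ z → cong χ (P≡Q (swap z)))

#-∩-comm : (P Q : Fin m × Fin n → Bool) → # (P ∩ Q) ≡ # (Q ∩ P)
#-∩-comm P Q = ∑²-cong λ z → cong χ (∧-comm (P z) (Q z))

#-∩-absorb : (P Q R : Fin m × Fin n → Bool) → (∀ z → T (P z) → T (R z) → T (Q z)) → # ((P ∩ Q) ∩ R) ≡ # (P ∩ R)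
#-∩-absorb P Q R P∩R⊆Q = ∑²-cong λ z → cong χ (pointwise (P z) (Q z) (R z) (P∩R⊆Q z))
  where
  pointwise : ∀ a b c → (T a → T c → T b) → (a ∧ b) ∧ c ≡ a ∧ c
  pointwise false _     _     _ = refl
  pointwise true  true  _     _ = refl
  pointwise true  false false _ = refl
  pointwise true  false true  h = contradiction (h _ _) λ ()

#-mono : {P Q : Fin m × Fin n → Bool} → (∀ z → T (P z) → T (Q z)) → # P ≤ # Q
#-mono P⊆Q = ∑²-mono-≤ λ z → pointwise (P⊆Q z)
  where
  pointwise : ∀ {a b} → (T a → T b) → χ a ≤ χ b
  pointwise {false}         _   = z≤n
  pointwise {true}  {true}  _   = ≤-refl
  pointwise {true}  {false} a⇒b = ⊥-elim (a⇒b _)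

#-witness : (P : Fin m × Fin n → Bool) {z : Fin m × Fin n} → T (P z) → 1 ≤ # P
#-witness P {z} Pz = ≤-trans (≤-reflexive (sym (χ-T Pz))) (term≤∑² (χ ∘ P) z)

#-empty : (P : Fin m × Fin n → Bool) → (∀ z → ¬ T (P z)) → # P ≡ 0
#-empty P ¬P = ∑-zero λ x → ∑-zero λ y → χ-F (¬P (x , y))

#-≡0⇒empty : (P : Fin m × Fin n → Bool) → # P ≡ 0 → ∀ z → ¬ T (P z)
#-≡0⇒empty P #P≡0 z Pz = contradiction (≤-trans (#-witness P Pz) (≤-reflexive #P≡0)) λ ()

#-split : (P Q : Fin m × Fin n → Bool) → # P ≡ # (Q ∩ P) + # (P ∖ Q)
#-split P Q = trans (∑²-cong λ z → pointwise (P z) (Q z)) (∑²-distrib-+ (χ ∘ (Q ∩ P)) (χ ∘ (P ∖ Q)))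
  where
  pointwise : ∀ a b → χ a ≡ χ (b ∧ a) + χ (a ∧ not b)
  pointwise false false = refl
  pointwise false true  = refl
  pointwise true  false = refl
  pointwise true  true  = refl

NoTriplePoint : (P A B C : Fin m × Fin n → Bool) → Set
NoTriplePoint P A B C = ∀ z → T (P z) → T (A z) → T (B z) → ¬ T (C z)

#-inclusion-exclusion₃ : (P A B C : Fin m × Fin n → Bool) → NoTriplePoint P A B C →
  # (P ∩ (A ∪ B ∪ C)) + (# (P ∩ A ∩ B) + # (P ∩ A ∩ C) + # (P ∩ B ∩ C)) ≡ # (P ∩ A) + # (P ∩ B) + # (P ∩ C)
#-inclusion-exclusion₃ P A B C no3 = begin
  # (P ∩ (A ∪ B ∪ C)) + (# (P ∩ A ∩ B) + # (P ∩ A ∩ C) + # (P ∩ B ∩ C))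
    ≡⟨ cong (# (P ∩ (A ∪ B ∪ C)) +_) (sym (∑²-distrib-+₃ (χ ∘ (P ∩ A ∩ B)) (χ ∘ (P ∩ A ∩ C)) (χ ∘ (P ∩ B ∩ C)))) ⟩
  # (P ∩ (A ∪ B ∪ C)) + ∑² (λ z → χ ((P ∩ A ∩ B) z) + χ ((P ∩ A ∩ C) z) + χ ((P ∩ B ∩ C) z))
    ≡⟨ sym (∑²-distrib-+ (χ ∘ (P ∩ (A ∪ B ∪ C))) _) ⟩
  ∑² (λ z → χ ((P ∩ (A ∪ B ∪ C)) z) + (χ ((P ∩ A ∩ B) z) + χ ((P ∩ A ∩ C) z) + χ ((P ∩ B ∩ C) z)))
    ≡⟨ ∑²-cong (λ z → pointwise (P z) (A z) (B z) (C z) (no3 z)) ⟩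
  ∑² (λ z → χ ((P ∩ A) z) + χ ((P ∩ B) z) + χ ((P ∩ C) z))
    ≡⟨ ∑²-distrib-+₃ (χ ∘ (P ∩ A)) (χ ∘ (P ∩ B)) (χ ∘ (P ∩ C)) ⟩
  # (P ∩ A) + # (P ∩ B) + # (P ∩ C) ∎
  where
  open ≡-Reasoning
  pointwise : ∀ p a b c → (T p → T a → T b → ¬ T c) →
    χ (p ∧ (a ∨ b ∨ c)) + (χ (p ∧ a ∧ b) + χ (p ∧ a ∧ c) + χ (p ∧ b ∧ c)) ≡ χ (p ∧ a) + χ (p ∧ b) + χ (p ∧ c)
  pointwise false _     _     _     _   = refl
  pointwise true  false false false _   = refl
  pointwise true  false false true  _   = refl
  pointwise true  false true  false _   = refl
  pointwise true  false true  true  _   = refl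
  pointwise true  true  false false _   = refl
  pointwise true  true  false true  _   = refl
  pointwise true  true  true  false _   = refl
  pointwise true  true  true  true  no3 = contradiction _ (no3 _ _ _)

#-∪₃-half : (P A B C : Fin m × Fin n → Bool) → NoTriplePoint P A B C →
  # (P ∩ A) + # (P ∩ B) + # (P ∩ C) ≤ 2 * # (P ∩ (A ∪ B ∪ C))
#-∪₃-half {m} {n} P A B C no3 = begin
  # (P ∩ A) + # (P ∩ B) + # (P ∩ C)
    ≡⟨ sym (∑²-distrib-+₃ (χ ∘ (P ∩ A)) (χ ∘ (P ∩ B)) (χ ∘ (P ∩ C))) ⟩
  ∑² (λ z → χ ((P ∩ A) z) + χ ((P ∩ B) z) + χ ((P ∩ C) z))
    ≤⟨ ∑²-mono-≤ (λ z → pointwise (P z) (A z) (B z) (C z) (no3 z)) ⟩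
  ∑² (λ z → 2 * χ ((P ∩ (A ∪ B ∪ C)) z))
    ≡⟨ trans (sum-cong-≗ λ x → ∑-*ˡ 2 λ y → χ ((P ∩ (A ∪ B ∪ C)) (x , y))) (∑-*ˡ 2 λ x → ∑[ y < n ] χ ((P ∩ (A ∪ B ∪ C)) (x , y))) ⟩
  2 * # (P ∩ (A ∪ B ∪ C)) ∎
  where
  open ≤-Reasoning
  pointwise : ∀ p a b c → (T p → T a → T b → ¬ T c) →
    χ (p ∧ a) + χ (p ∧ b) + χ (p ∧ c) ≤ 2 * χ (p ∧ (a ∨ b ∨ c))
  pointwise false _     _     _     _   = z≤n
  pointwise true  false false false _   = z≤n
  pointwise true  false false true  _   = s≤s z≤n
  pointwise true  false true  false _   = s≤s z≤n
  pointwise true  false true  true  _   = s≤s (s≤s z≤n)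
  pointwise true  true  false false _   = s≤s z≤n
  pointwise true  true  false true  _   = s≤s (s≤s z≤n)
  pointwise true  true  true  false _   = s≤s (s≤s z≤n)
  pointwise true  true  true  true  no3 = contradiction _ (no3 _ _ _)

#-∪₃-disjoint : (P A B C : Fin m × Fin n → Bool) → # (P ∩ A ∩ B) ≡ 0 → # (P ∩ A ∩ C) ≡ 0 → # (P ∩ B ∩ C) ≡ 0 →
  # (P ∩ (A ∪ B ∪ C)) ≡ # (P ∩ A) + # (P ∩ B) + # (P ∩ C)
#-∪₃-disjoint P A B C AB AC BC = begin
  # (P ∩ (A ∪ B ∪ C))                                                      ≡⟨ sym (+-identityʳ _) ⟩
  # (P ∩ (A ∪ B ∪ C)) + (0 + 0 + 0)                                        ≡⟨ cong (λ k → # (P ∩ (A ∪ B ∪ C)) + k) (sym (cong₂ _+_ (cong₂ _+_ AB AC) BC)) ⟩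
  # (P ∩ (A ∪ B ∪ C)) + (# (P ∩ A ∩ B) + # (P ∩ A ∩ C) + # (P ∩ B ∩ C))  ≡⟨ #-inclusion-exclusion₃ P A B C no-triple ⟩
  # (P ∩ A) + # (P ∩ B) + # (P ∩ C)                                        ∎
  where
  open ≡-Reasoning
  no-triple : NoTriplePoint P A B C
  no-triple z Pz Az Bz _ = #-≡0⇒empty (P ∩ A ∩ B) AB z (T-∧-intro Pz (T-∧-intro Az Bz))

#-∪₃-overlapping : (P A B C : Fin m × Fin n → Bool) → NoTriplePoint P A B C →
  1 ≤ # (P ∩ A ∩ B) → 1 ≤ # (P ∩ A ∩ C) → 1 ≤ # (P ∩ B ∩ C) →
  # (P ∩ (A ∪ B ∪ C)) + 3 ≤ # (P ∩ A) + # (P ∩ B) + # (P ∩ C)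
#-∪₃-overlapping P A B C no-triple AB AC BC = begin
  # (P ∩ (A ∪ B ∪ C)) + 3                                                  ≤⟨ +-monoʳ-≤ _ (+-mono-≤ (+-mono-≤ AB AC) BC) ⟩
  # (P ∩ (A ∪ B ∪ C)) + (# (P ∩ A ∩ B) + # (P ∩ A ∩ C) + # (P ∩ B ∩ C))  ≡⟨ #-inclusion-exclusion₃ P A B C no-triple ⟩
  # (P ∩ A) + # (P ∩ B) + # (P ∩ C)                                        ∎
  where open ≤-Reasoning

sumOver : {A : Set} → List A → (A → ℕ) → ℕ
sumOver []      f = 0
sumOver (a ∷ as) f = f a + sumOver as f

syntax sumOver L (λ ℓ → e) = ∑[ ℓ ∈ L ] e

∑ₗ-mono-≤ : {A : Set} {L : List A} {f g : A → ℕ} → All (λ a → f a ≤ g a) L → sumOver L f ≤ sumOver L g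
∑ₗ-mono-≤ []         = z≤n
∑ₗ-mono-≤ (h ∷ rest) = +-mono-≤ h (∑ₗ-mono-≤ rest)

∑ₗ-distrib-+ : {A : Set} (L : List A) (f g : A → ℕ) → ∑[ a ∈ L ] (f a + g a) ≡ ∑[ a ∈ L ] f a + ∑[ a ∈ L ] g a
∑ₗ-distrib-+ []      f g = refl
∑ₗ-distrib-+ (a ∷ L) f g = trans (cong (f a + g a +_) (∑ₗ-distrib-+ L f g)) (+-assoc-middle (f a) (g a) _ _)
  where
  +-assoc-middle : ∀ w x y z → w + x + (y + z) ≡ w + y + (x + z)
  +-assoc-middle = solve-∀

∑ₗ-*ˡ : {A : Set} (L : List A) (k : ℕ) (f : A → ℕ) → ∑[ a ∈ L ] (k * f a) ≡ k * ∑[ a ∈ L ] f a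
∑ₗ-*ˡ []      k f = sym (*-zeroʳ k)
∑ₗ-*ˡ (a ∷ L) k f = trans (cong (k * f a +_) (∑ₗ-*ˡ L k f)) (sym (*-distribˡ-+ k (f a) _))

∑ₗ-const : {A : Set} (L : List A) (k : ℕ) → ∑[ a ∈ L ] k ≡ length L * k
∑ₗ-const []      k = refl
∑ₗ-const (a ∷ L) k = cong (k +_) (∑ₗ-const L k)

∑ₗ-χ-complement : {A : Set} (L : List A) (P : A → Bool) → ∑[ a ∈ L ] χ (not (P a)) + ∑[ a ∈ L ] χ (P a) ≡ length L
∑ₗ-χ-complement L P = trans (sym (∑ₗ-distrib-+ L _ _)) (count L)
  where
  count : ∀ L → ∑[ a ∈ L ] (χ (not (P a)) + χ (P a)) ≡ length L
  count []      = refl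
  count (a ∷ L) with P a
  ... | true  = cong suc (count L)
  ... | false = cong suc (count L)

∑ₗ-χ-any : {A : Set} {L : List A} (P : A → Bool) → Any (T ∘ P) L → 1 ≤ ∑[ a ∈ L ] χ (P a)
∑ₗ-χ-any P (here Pa)  = ≤-trans (≤-reflexive (sym (χ-T Pa))) (m≤m+n _ _)
∑ₗ-χ-any P (there h) = ≤-trans (∑ₗ-χ-any P h) (m≤n+m _ _)

∑ₗ-χ-split : {A : Set} (L : List A) (P Q : A → Bool) →
  ∑[ a ∈ L ] χ (P a) ≡ ∑[ a ∈ L ] χ (P a ∧ Q a) + ∑[ a ∈ L ] χ (P a ∧ not (Q a))
∑ₗ-χ-split L P Q = trans (pointwise L) (∑ₗ-distrib-+ L _ _)
  where
  pointwise : ∀ L → ∑[ a ∈ L ] χ (P a) ≡ ∑[ a ∈ L ] (χ (P a ∧ Q a) + χ (P a ∧ not (Q a)))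
  pointwise []      = refl
  pointwise (a ∷ L) with P a | Q a
  ... | false | _     = pointwise L
  ... | true  | true  = cong suc (pointwise L)
  ... | true  | false = cong suc (pointwise L)

union-bound : {A : Set} (L : List A) (on : A → Fin m × Fin n → Bool) (P : Fin m × Fin n → Bool) →
  (∀ z → T (P z) → Any (λ ℓ → T (on ℓ z)) L) → # P ≤ ∑[ ℓ ∈ L ] # (on ℓ ∩ P)
union-bound [] on P covered = ≤-reflexive (#-empty P λ z Pz → case (covered z Pz))
  where
  case : ∀ {A : Set} {Q : A → Set} → ¬ Any Q []
  case ()
union-bound (ℓ ∷ L) on P covered = begin
  # P                                       ≡⟨ #-split P (on ℓ) ⟩
  # (on ℓ ∩ P) + # (P ∖ on ℓ)               ≤⟨ +-monoʳ-≤ _ (union-bound L on (P ∖ on ℓ) rest-covered) ⟩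
  # (on ℓ ∩ P) + ∑[ ℓ′ ∈ L ] # (on ℓ′ ∩ (P ∖ on ℓ)) ≤⟨ +-monoʳ-≤ _ (∑ₗ-mono-≤ (shrink L)) ⟩
  ∑[ ℓ′ ∈ ℓ ∷ L ] # (on ℓ′ ∩ P)             ∎
  where
  open ≤-Reasoning
  rest-covered : ∀ z → T ((P ∖ on ℓ) z) → Any (λ ℓ′ → T (on ℓ′ z)) L
  rest-covered z h with covered z (T-∧ˡ (P z) h)
  ... | here onℓ  = contradiction onℓ (T-not⇒¬T (on ℓ z) (T-∧ʳ (P z) h))
  ... | there hit = hit
  T-∧-weaken : ∀ a b {c} → T (a ∧ b ∧ c) → T (a ∧ b)
  T-∧-weaken true true _ = _
  shrink : ∀ L′ → All (λ ℓ′ → # (on ℓ′ ∩ (P ∖ on ℓ)) ≤ # (on ℓ′ ∩ P)) L′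
  shrink [] = []
  shrink (ℓ′ ∷ L′) = #-mono (λ z h → T-∧-weaken (on ℓ′ z) (P z) h) ∷ shrink L′

module Congruence (p : ℕ) {{_ : NonZero p}} (prime : Prime p) where

  open import Data.Integer.Base using (+_; -[1+_]; -_; _-_; 0ℤ)

  infix 4 _≋_

  record _≋_ (i j : ℤ) : Set where
    constructor congruent
    field
      p∣i-j : + p ∣ i - j

  ≋-sym : ∀ {i j} → i ≋ j → j ≋ i
  ≋-sym {i} {j} (congruent i≋j) = congruent (subst (+ p ∣_) (negate i j) (∣m⇒∣-m i≋j))
    where
    negate : ∀ i j → - (i - j) ≡ j - i
    negate = ℤ-Solver.solve-∀

  ≋-trans : ∀ {i j k} → i ≋ j → j ≋ k → i ≋ k
  ≋-trans {i} {j} {k} (congruent i≋j) (congruent j≋k) = congruent (subst (+ p ∣_) (telescope i j k) (∣m∣n⇒∣m+n i≋j j≋k))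
    where
    telescope : ∀ i j k → (i - j) ℤ.+ (j - k) ≡ i - k
    telescope = ℤ-Solver.solve-∀

  ≋-- : ∀ {i j k l} → i ≋ j → k ≋ l → i - k ≋ j - l
  ≋-- {i} {j} {k} {l} (congruent i≋j) (congruent k≋l) = congruent (subst (+ p ∣_) (regroup i j k l) (∣m∣n⇒∣m-n i≋j k≋l))
    where
    regroup : ∀ i j k l → (i - j) - (k - l) ≡ (i - k) - (j - l)
    regroup = ℤ-Solver.solve-∀

  ≋-*ˡ : ∀ k {i j} → i ≋ j → k ℤ.* i ≋ k ℤ.* j
  ≋-*ˡ k {i} {j} (congruent i≋j) = congruent (subst (+ p ∣_) (distrib k i j) (∣n⇒∣m*n k i≋j))
    where
    distrib : ∀ k i j → k ℤ.* (i - j) ≡ k ℤ.* i - k ℤ.* j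
    distrib = ℤ-Solver.solve-∀

  %≡⇒≋ : ∀ {m n} → m % p ≡ n % p → + m ≋ + n
  %≡⇒≋ {m} {n} eq = congruent (divides (+ (m / p) - + (n / p)) (begin
    + m - + n                                           ≡⟨ cong₂ (λ u v → + u - + v) (m≡m%n+[m/n]*n m p) (m≡m%n+[m/n]*n n p) ⟩
    + (m % p + m / p * p) - + (n % p + n / p * p)       ≡⟨ cong₂ _-_ (cast (m % p) (m / p)) (cast (n % p) (n / p)) ⟩
    + (m % p) ℤ.+ + (m / p) ℤ.* + p - (+ (n % p) ℤ.+ + (n / p) ℤ.* + p)
                                                        ≡⟨ cong (λ r → + r ℤ.+ + (m / p) ℤ.* + p - (+ (n % p) ℤ.+ + (n / p) ℤ.* + p)) eq ⟩
    + (n % p) ℤ.+ + (m / p) ℤ.* + p - (+ (n % p) ℤ.+ + (n / p) ℤ.* + p)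
                                                        ≡⟨ cancel (+ (n % p)) (+ (m / p)) (+ (n / p)) (+ p) ⟩
    (+ (m / p) - + (n / p)) ℤ.* + p                     ∎))
    where
    open ≡-Reasoning
    cast : ∀ r a → + (r + a * p) ≡ + r ℤ.+ + a ℤ.* + p
    cast r a = trans (ℤ.pos-+ r (a * p)) (cong (λ x → + r ℤ.+ x) (ℤ.pos-* a p))
    cancel : ∀ r a b q → r ℤ.+ a ℤ.* q - (r ℤ.+ b ℤ.* q) ≡ (a - b) ℤ.* q
    cancel = ℤ-Solver.solve-∀

  ≋⇒%≡ : ∀ {m n} → + m ≋ + n → m % p ≡ n % p
  ≋⇒%≡ {m} {n} (congruent (divides (+ k) eq)) = begin
    m % p           ≡⟨ cong (_% p) (ℤ.+-injective m≡) ⟩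
    (n + k * p) % p ≡⟨ [m+kn]%n≡m%n n k p ⟩
    n % p           ∎
    where
    open ≡-Reasoning
    split : ∀ a b → a ≡ b ℤ.+ (a - b)
    split = ℤ-Solver.solve-∀
    m≡ : + m ≡ + (n + k * p)
    m≡ = trans (split (+ m) (+ n)) (trans (cong (λ x → + n ℤ.+ x) eq)
           (trans (cong (λ x → + n ℤ.+ x) (sym (ℤ.pos-* k p))) (sym (ℤ.pos-+ n (k * p)))))
  ≋⇒%≡ {m} {n} (congruent (divides -[1+ k ] eq)) = sym (begin
    n % p                 ≡⟨ cong (_% p) (ℤ.+-injective n≡) ⟩
    (m + suc k * p) % p   ≡⟨ [m+kn]%n≡m%n m (suc k) p ⟩
    m % p                 ∎)
    where
    open ≡-Reasoning
    back : ∀ a b → b ≡ a - (a - b)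
    back = ℤ-Solver.solve-∀
    flip : ∀ a c d → a - (- c) ℤ.* d ≡ a ℤ.+ c ℤ.* d
    flip = ℤ-Solver.solve-∀
    n≡ : + n ≡ + (m + suc k * p)
    n≡ = trans (back (+ m) (+ n)) (trans (cong (λ x → + m - x) eq) (trans (flip (+ m) (+ suc k) (+ p))
           (trans (cong (λ x → + m ℤ.+ x) (sym (ℤ.pos-* (suc k) p))) (sym (ℤ.pos-+ m (suc k * p))))))

  ≋⇒≡ : ∀ {m n} → m < p → n < p → + m ≋ + n → m ≡ n
  ≋⇒≡ m<p n<p m≋n = trans (sym (m<n⇒m%n≡m m<p)) (trans (≋⇒%≡ m≋n) (m<n⇒m%n≡m n<p))

  0<n<p⇒p∤n : ∀ {n} → 0 < n → n < p → ¬ (+ p ∣ + n)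
  0<n<p⇒p∤n {n} 0<n n<p p∣n = <-irrefl refl (<-≤-trans n<p (ℕ.∣⇒≤ {{>-nonZero 0<n}} (∣⇒∣ᵤ p∣n)))

  p∣i*j⇒p∣i⊎p∣j : ∀ {i j} → + p ∣ i ℤ.* j → + p ∣ i ⊎ + p ∣ j
  p∣i*j⇒p∣i⊎p∣j {i} {j} p∣ij = Sum.map ∣ᵤ⇒∣ ∣ᵤ⇒∣ (euclidsLemma ℤ.∣ i ∣ ℤ.∣ j ∣ prime (subst (p ℕ.∣_) (ℤ.abs-* i j) (∣⇒∣ᵤ p∣ij)))

  ≋-*-cancelˡ : ∀ {k i j} → ¬ (+ p ∣ k) → k ℤ.* i ≋ k ℤ.* j → i ≋ j
  ≋-*-cancelˡ {k} {i} {j} p∤k (congruent ki≋kj) = congruent ([ (λ p∣k → ⊥-elim (p∤k p∣k)) , id ]′ (p∣i*j⇒p∣i⊎p∣j (subst (+ p ∣_) (factor k i j) ki≋kj)))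
    where
    factor : ∀ k i j → k ℤ.* i - k ℤ.* j ≡ k ℤ.* (i - j)
    factor = ℤ-Solver.solve-∀

module Lines (p : ℕ) {{_ : NonZero p}} (prime : Prime p) where

  open import Data.Integer.Base using (+_; -_; _-_)

  open Congruence p prime

  record Equation : Set where
    constructor equation
    field
      a b c : ℕ
      c<p   : c < p

  open Equation

  infix 4 _∈ₑ_ _∈ₑ?_

  eqn : Line p → Equation
  eqn ℓ = equation (toℕ (Line.a ℓ)) (toℕ (Line.b ℓ)) (toℕ (Line.c ℓ)) (Fin.toℕ<n (Line.c ℓ))

  eval : Equation → Point p → ℕ
  eval e (x , y) = (a e * toℕ x + b e * toℕ y) % p

  record _∈ₑ_ (z : Point p) (e : Equation) : Set where
    constructor on
    field
      eval≡c : eval e z ≡ c e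

  open _∈ₑ_ public

  _∈ₑ?_ : ∀ z e → Dec (z ∈ₑ e)
  z ∈ₑ? e = map′ on eval≡c (eval e z ≟ c e)

  ⟦_⟧ : Equation → Point p → Bool
  ⟦ e ⟧ z = ⌊ z ∈ₑ? e ⌋

  form : Equation → Point p → ℤ
  form e (x , y) = + a e ℤ.* + toℕ x ℤ.+ + b e ℤ.* + toℕ y

  form-cast : ∀ e x y → + (a e * toℕ x + b e * toℕ y) ≡ form e (x , y)
  form-cast e x y = trans (ℤ.pos-+ (a e * toℕ x) (b e * toℕ y)) (cong₂ ℤ._+_ (ℤ.pos-* (a e) (toℕ x)) (ℤ.pos-* (b e) (toℕ y)))

  ∈ₑ⇒≋ : ∀ {z} e → z ∈ₑ e → form e z ≋ + c e
  ∈ₑ⇒≋ {x , y} e (on z∈e) = subst (_≋ + c e) (form-cast e x y) (%≡⇒≋ (trans z∈e (sym (m<n⇒m%n≡m (c<p e)))))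

  ≋⇒∈ₑ : ∀ {z} e → form e z ≋ + c e → z ∈ₑ e
  ≋⇒∈ₑ {x , y} e z≋c = on (trans (≋⇒%≡ (subst (_≋ + c e) (sym (form-cast e x y)) z≋c)) (m<n⇒m%n≡m (c<p e)))

  det : Equation → Equation → ℤ
  det e f = + a e ℤ.* + b f - + a f ℤ.* + b e

  record Transversal (e f : Equation) : Set where
    constructor transversal
    field
      p∤det : ¬ (+ p ∣ det e f)

  transversal-unique : ∀ {e f z w} → Transversal e f →
    z ∈ₑ e → z ∈ₑ f → w ∈ₑ e → w ∈ₑ f → z ≡ w
  transversal-unique {e} {f} {x , y} {x′ , y′} (transversal p∤det) z∈e z∈f w∈e w∈f =
    cong₂ _,_ (coordinate eliminate-y) (coordinate eliminate-x)
    where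
    along-e : form e (x , y) ≋ form e (x′ , y′)
    along-e = ≋-trans (∈ₑ⇒≋ e z∈e) (≋-sym (∈ₑ⇒≋ e w∈e))
    along-f : form f (x , y) ≋ form f (x′ , y′)
    along-f = ≋-trans (∈ₑ⇒≋ f z∈f) (≋-sym (∈ₑ⇒≋ f w∈f))
    coordinate : ∀ {u v : Fin p} → det e f ℤ.* + toℕ u ≋ det e f ℤ.* + toℕ v → u ≡ v
    coordinate eq = Fin.toℕ-injective (≋⇒≡ (Fin.toℕ<n _) (Fin.toℕ<n _) (≋-*-cancelˡ p∤det eq))
    eliminate-y : det e f ℤ.* + toℕ x ≋ det e f ℤ.* + toℕ x′
    eliminate-y = subst₂ _≋_ (sym (elim-y (+ a e) (+ b e) (+ a f) (+ b f) _ _)) (sym (elim-y (+ a e) (+ b e) (+ a f) (+ b f) _ _))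
      (≋-- (≋-*ˡ (+ b f) along-e) (≋-*ˡ (+ b e) along-f))
      where
      elim-y : ∀ ae be af bf x y → (ae ℤ.* bf - af ℤ.* be) ℤ.* x ≡ bf ℤ.* (ae ℤ.* x ℤ.+ be ℤ.* y) - be ℤ.* (af ℤ.* x ℤ.+ bf ℤ.* y)
      elim-y = ℤ-Solver.solve-∀
    eliminate-x : det e f ℤ.* + toℕ y ≋ det e f ℤ.* + toℕ y′
    eliminate-x = subst₂ _≋_ (sym (elim-x (+ a e) (+ b e) (+ a f) (+ b f) _ _)) (sym (elim-x (+ a e) (+ b e) (+ a f) (+ b f) _ _))
      (≋-- (≋-*ˡ (+ a e) along-f) (≋-*ˡ (+ a f) along-e))
      where
      elim-x : ∀ ae be af bf x y → (ae ℤ.* bf - af ℤ.* be) ℤ.* y ≡ ae ℤ.* (af ℤ.* x ℤ.+ bf ℤ.* y) - af ℤ.* (ae ℤ.* x ℤ.+ be ℤ.* y)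
      elim-x = ℤ-Solver.solve-∀

  eval<p : ∀ e z → eval e z < p
  eval<p e (x , y) = m%n<n _ p

  through : Equation → Point p → Equation
  through e z = equation (a e) (b e) (eval e z) (eval<p e z)

  ∈-through : ∀ e z → z ∈ₑ through e z
  ∈-through e z = on refl

  value : Equation → Point p → Fin p
  value e z = fromℕ< (eval<p e z)

  value-injective : ∀ e {z w} → value e z ≡ value e w → w ∈ₑ through e z
  value-injective e {z} {w} eq = on (sym (trans (sym (Fin.toℕ-fromℕ< (eval<p e z))) (trans (cong toℕ eq) (Fin.toℕ-fromℕ< (eval<p e w)))))

  value-∈ : ∀ e {z} → value e z ≡ fromℕ< (c<p e) → z ∈ₑ e
  value-∈ e {z} eq = on (trans (sym (Fin.toℕ-fromℕ< (eval<p e z))) (trans (cong toℕ eq) (Fin.toℕ-fromℕ< (c<p e))))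

  row column antidiagonal : (c : ℕ) → c < p → Equation
  row          c = equation 0 1 c
  column       c = equation 1 0 c
  antidiagonal c = equation 1 1 c

  ∈-row : ∀ {c c<p x y} → (x , y) ∈ₑ row c c<p ⇔ toℕ y ≡ c
  ∈-row {x = x} {y} = mk⇔ (trans (sym value≡) ∘ eval≡c) (on ∘ trans value≡)
    where
    value≡ : (0 * toℕ x + 1 * toℕ y) % p ≡ toℕ y
    value≡ = trans (cong (_% p) (+-identityʳ (toℕ y))) (m<n⇒m%n≡m (Fin.toℕ<n y))

  ∈-column : ∀ {c c<p x y} → (x , y) ∈ₑ column c c<p ⇔ toℕ x ≡ c
  ∈-column {x = x} {y} = mk⇔ (trans (sym value≡) ∘ eval≡c) (on ∘ trans value≡)
    where
    value≡ : (1 * toℕ x + 0 * toℕ y) % p ≡ toℕ x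
    value≡ = trans (cong (_% p) (trans (+-identityʳ _) (+-identityʳ (toℕ x)))) (m<n⇒m%n≡m (Fin.toℕ<n x))

  ∈-antidiagonal : ∀ {c c<p x y} → (x , y) ∈ₑ antidiagonal c c<p ⇔ (toℕ x + toℕ y) % p ≡ c
  ∈-antidiagonal {x = x} {y} = mk⇔ (trans (sym value≡) ∘ eval≡c) (on ∘ trans value≡)
    where
    value≡ : (1 * toℕ x + 1 * toℕ y) % p ≡ (toℕ x + toℕ y) % p
    value≡ = cong (_% p) (cong₂ _+_ (+-identityʳ (toℕ x)) (+-identityʳ (toℕ y)))

  det-row : ∀ e {c c<p} → det e (row c c<p) ≡ + a e
  det-row e = identity (+ a e) (+ b e)
    where
    identity : ∀ a b → a ℤ.* ℤ.1ℤ - ℤ.0ℤ ℤ.* b ≡ a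
    identity = ℤ-Solver.solve-∀

  det-column : ∀ e {c c<p} → det e (column c c<p) ≡ - (+ b e)
  det-column e = identity (+ a e) (+ b e)
    where
    identity : ∀ a b → a ℤ.* ℤ.0ℤ - ℤ.1ℤ ℤ.* b ≡ - b
    identity = ℤ-Solver.solve-∀

  det-antidiagonal : ∀ e {c c<p} → det e (antidiagonal c c<p) ≡ + a e - + b e
  det-antidiagonal e = identity (+ a e) (+ b e)
    where
    identity : ∀ a b → a ℤ.* ℤ.1ℤ - ℤ.1ℤ ℤ.* b ≡ a - b
    identity = ℤ-Solver.solve-∀

  transversal-row : ∀ {e c c<p} → ¬ (+ p ∣ + a e) → Transversal e (row c c<p)
  transversal-row {e} {c} {c<p} p∤a = transversal λ p∣det → p∤a (subst (+ p ∣_) (det-row e {c} {c<p}) p∣det)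

  transversal-column : ∀ {e c c<p} → ¬ (+ p ∣ + b e) → Transversal e (column c c<p)
  transversal-column {e} {c} {c<p} p∤b = transversal λ p∣det → p∤b (subst (+ p ∣_) (ℤ.neg-involutive (+ b e)) (∣m⇒∣-m (subst (+ p ∣_) (det-column e {c} {c<p}) p∣det)))

  transversal-antidiagonal : ∀ {e c c<p} → ¬ (+ p ∣ + a e - + b e) → Transversal e (antidiagonal c c<p)
  transversal-antidiagonal {e} {c} {c<p} p∤a-b = transversal λ p∣det → p∤a-b (subst (+ p ∣_) (det-antidiagonal e {c} {c<p}) p∣det)

  module Graph (e : Equation) (p∤b : ¬ (+ p ∣ + b e)) where

    private
      on-column : ∀ x y → (x , y) ∈ₑ column (toℕ x) (Fin.toℕ<n x)
      on-column x y = Equivalence.from ∈-column refl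

      solutions : ∀ x → ∃ λ y → value e (x , y) ≡ fromℕ< (c<p e)
      solutions x = injective⇒surjective injective (fromℕ< (c<p e))
        where
        injective : ∀ {y y′} → value e (x , y) ≡ value e (x , y′) → y ≡ y′
        injective {y} {y′} eq = cong proj₂ (transversal-unique (transversal-column {through e (x , y)} p∤b)
          (∈-through e (x , y)) (on-column x y) (value-injective e eq) (on-column x y′))

    -- Abstract: letting the unifier unfold the search behind graph is prohibitively slow.
    abstract
      graph : Fin p → Fin p
      graph x = proj₁ (solutions x)

      graph-∈ : ∀ x → (x , graph x) ∈ₑ e
      graph-∈ x = value-∈ e (proj₂ (solutions x))

    graph-unique : ∀ {x y} → (x , y) ∈ₑ e → y ≡ graph x
    graph-unique {x} {y} y∈e = cong proj₂ (transversal-unique (transversal-column p∤b)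
      y∈e (on-column x y) (graph-∈ x) (on-column x (graph x)))

    ∑²-along : (g : Point p → ℕ) → ∑² (λ z → χ (⟦ e ⟧ z) * g z) ≡ ∑[ x < p ] g (x , graph x)
    ∑²-along g = sum-cong-≗ λ x →
      ∑-unique (λ y → ⟦ e ⟧ (x , y)) (λ y → g (x , y)) (fromWitness (graph-∈ x)) (λ y h → graph-unique (toWitness h))

    #-along : (P : Point p → Bool) → # (⟦ e ⟧ ∩ P) ≡ ∑[ x < p ] χ (P (x , graph x))
    #-along P = trans (∑²-cong λ z → χ-∧ (⟦ e ⟧ z) (P z)) (∑²-along (χ ∘ P))

  transversal-sym : ∀ {e f} → Transversal e f → Transversal f e
  transversal-sym {e} {f} (transversal p∤det) = transversal λ p∣det → p∤det (subst (+ p ∣_) (flip (+ a e) (+ b e) (+ a f) (+ b f)) (∣m⇒∣-m p∣det))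
    where
    flip : ∀ ae be af bf → - (af ℤ.* be - ae ℤ.* bf) ≡ ae ℤ.* bf - af ℤ.* be
    flip = ℤ-Solver.solve-∀

  private
    meet-along-graph : ∀ {e f} (p∤b : ¬ (+ p ∣ + b e)) → Transversal e f → # (⟦ e ⟧ ∩ ⟦ f ⟧) ≡ 1
    meet-along-graph {e} {f} p∤b t = begin
      # (⟦ e ⟧ ∩ ⟦ f ⟧)                          ≡⟨ #-along ⟦ f ⟧ ⟩
      ∑[ x < p ] χ (⟦ f ⟧ (x , graph x))         ≡⟨ sum-cong-≗ {x = λ x → χ (⟦ f ⟧ (x , graph x))} (λ x → sym (*-identityʳ (χ (⟦ f ⟧ (x , graph x))))) ⟩
      ∑[ x < p ] (χ (⟦ f ⟧ (x , graph x)) * 1)   ≡⟨ ∑-unique (λ x → ⟦ f ⟧ (x , graph x)) (λ _ → 1) (fromWitness x₀∈f) unique ⟩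
      1                                          ∎
      where
      open ≡-Reasoning
      open Graph e p∤b
      value-along-injective : ∀ {x x′} → value f (x , graph x) ≡ value f (x′ , graph x′) → x ≡ x′
      value-along-injective {x} {x′} eq = cong proj₁ (transversal-unique (transversal (Transversal.p∤det t))
        (graph-∈ x) (∈-through f (x , graph x)) (graph-∈ x′) (value-injective f eq))
      hit : ∃ λ x → value f (x , graph x) ≡ fromℕ< (c<p f)
      hit = injective⇒surjective value-along-injective (fromℕ< (c<p f))
      x₀ : Fin p
      x₀ = proj₁ hit
      x₀∈f : (x₀ , graph x₀) ∈ₑ f
      x₀∈f = value-∈ f (proj₂ hit)
      unique : ∀ x → T (⟦ f ⟧ (x , graph x)) → x ≡ x₀
      unique x h = cong proj₁ (transversal-unique t (graph-∈ x) (toWitness h) (graph-∈ x₀) x₀∈f)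

  transversal-meet : ∀ {e f} → Transversal e f → # (⟦ e ⟧ ∩ ⟦ f ⟧) ≡ 1
  transversal-meet {e} {f} t with + p ∣? + b e | + p ∣? + b f
  ... | no p∤be  | _        = meet-along-graph p∤be t
  ... | yes _    | no p∤bf  = trans (#-∩-comm ⟦ e ⟧ ⟦ f ⟧) (meet-along-graph p∤bf (transversal-sym t))
  ... | yes p∣be | yes p∣bf = ⊥-elim (Transversal.p∤det t (∣m∣n⇒∣m-n (∣n⇒∣m*n (+ a e) p∣bf) (∣n⇒∣m*n (+ a f) p∣be)))

  NonDegenerate : Equation → Set
  NonDegenerate e = ¬ (+ p ∣ + a e) ⊎ ¬ (+ p ∣ + b e)

  parallel-⊆ : ∀ {e f w z} → + p ∣ det e f → NonDegenerate e → w ∈ₑ e → w ∈ₑ f → z ∈ₑ e → z ∈ₑ f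
  parallel-⊆ {e} {f} {x′ , y′} {x , y} p∣det nondegenerate w∈e w∈f z∈e =
    ≋⇒∈ₑ f (≋-trans same-on-f (∈ₑ⇒≋ f w∈f))
    where
    X X′ Y Y′ : ℤ
    X = + toℕ x
    X′ = + toℕ x′
    Y = + toℕ y
    Y′ = + toℕ y′
    same-on-e : + p ∣ form e (x , y) - form e (x′ , y′)
    same-on-e = _≋_.p∣i-j (≋-trans (∈ₑ⇒≋ e z∈e) (≋-sym (∈ₑ⇒≋ e w∈e)))
    eliminate-b : ∀ a₁ b₁ a₂ b₂ X Y X′ Y′ →
      a₁ ℤ.* (a₂ ℤ.* X ℤ.+ b₂ ℤ.* Y) - a₁ ℤ.* (a₂ ℤ.* X′ ℤ.+ b₂ ℤ.* Y′)
        ≡ a₂ ℤ.* ((a₁ ℤ.* X ℤ.+ b₁ ℤ.* Y) - (a₁ ℤ.* X′ ℤ.+ b₁ ℤ.* Y′)) ℤ.+ (a₁ ℤ.* b₂ - a₂ ℤ.* b₁) ℤ.* (Y - Y′)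
    eliminate-b = ℤ-Solver.solve-∀
    eliminate-a : ∀ a₁ b₁ a₂ b₂ X Y X′ Y′ →
      b₁ ℤ.* (a₂ ℤ.* X ℤ.+ b₂ ℤ.* Y) - b₁ ℤ.* (a₂ ℤ.* X′ ℤ.+ b₂ ℤ.* Y′)
        ≡ b₂ ℤ.* ((a₁ ℤ.* X ℤ.+ b₁ ℤ.* Y) - (a₁ ℤ.* X′ ℤ.+ b₁ ℤ.* Y′)) - (a₁ ℤ.* b₂ - a₂ ℤ.* b₁) ℤ.* (X - X′)
    eliminate-a = ℤ-Solver.solve-∀
    same-on-f : form f (x , y) ≋ form f (x′ , y′)
    same-on-f = [ via-a , via-b ]′ nondegenerate
      where
      via-a : ¬ (+ p ∣ + a e) → form f (x , y) ≋ form f (x′ , y′)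
      via-a p∤a = ≋-*-cancelˡ p∤a (congruent (subst (+ p ∣_)
              (sym (eliminate-b (+ a e) (+ b e) (+ a f) (+ b f) X Y X′ Y′))
              (∣m∣n⇒∣m+n (∣n⇒∣m*n (+ a f) same-on-e) (∣m⇒∣m*n (Y - Y′) p∣det))))
      via-b : ¬ (+ p ∣ + b e) → form f (x , y) ≋ form f (x′ , y′)
      via-b p∤b = ≋-*-cancelˡ p∤b (congruent (subst (+ p ∣_)
              (sym (eliminate-a (+ a e) (+ b e) (+ a f) (+ b f) X Y X′ Y′))
              (∣m∣n⇒∣m-n (∣n⇒∣m*n (+ b f) same-on-e) (∣m⇒∣m*n (X - X′) p∣det))))

  Meet : Equation → Equation → Set
  Meet e f = ∃ λ z → z ∈ₑ e × z ∈ₑ f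

  meet? : ∀ e f → Dec (Meet e f)
  meet? e f = map′ (λ (x , y , h) → (x , y) , h) (λ ((x , y) , h) → x , y , h)
    (Fin.any? λ x → Fin.any? λ y → ((x , y) ∈ₑ? e) ×-dec ((x , y) ∈ₑ? f))

  line-nondegenerate : ∀ ℓ → NonDegenerate (eqn ℓ)
  line-nondegenerate ℓ with toℕ (Line.a ℓ) ≟ 0
  ... | no  a≢0 = inj₁ (0<n<p⇒p∤n (n≢0⇒n>0 a≢0) (Fin.toℕ<n (Line.a ℓ)))
  ... | yes a≡0 = inj₂ (0<n<p⇒p∤n (n≢0⇒n>0 λ b≡0 → Line.nondeg ℓ (a≡0 , b≡0)) (Fin.toℕ<n (Line.b ℓ)))

module Staircase (p : ℕ) {{_ : NonZero p}} (prime : Prime p) where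

  open Lines p prime

  InS∖0? : ∀ z → Dec (InS∖0 z)
  InS∖0? (x , y) = (toℕ x + toℕ y <? p + 1) ×-dec ¬? ((toℕ x ≟ 0) ×-dec (toℕ y ≟ 0))

  S∖0 : Point p → Bool
  S∖0 z = ⌊ InS∖0? z ⌋

  ≤p⇔<p+1 : ∀ {m} → m ≤ p ⇔ m < p + 1
  ≤p⇔<p+1 {m} = mk⇔ (λ m≤p → ≤-trans (s≤s m≤p) (≤-reflexive (+-comm 1 p)))
                     (λ m<p+1 → m<1+n⇒m≤n (≤-trans m<p+1 (≤-reflexive (+-comm p 1))))

  slice-size : ∀ x → toℕ x ≢ 0 → ∑[ y < p ] χ (S∖0 (x , y)) ≡ suc (p ∸ toℕ x)
  slice-size x x≢0 = trans (sum-cong-≗ λ y → cong χ (⌊⌋-cong _ _ (to y) (from y))) (count-≤ (p ∸ toℕ x) p∸x<p)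
    where
    p∸x<p : p ∸ toℕ x < p
    p∸x<p = ∸-monoʳ-< (n≢0⇒n>0 x≢0) (<⇒≤ (Fin.toℕ<n x))
    to : ∀ y → InS∖0 (x , y) → toℕ y ≤ p ∸ toℕ x
    to y (x+y<p+1 , _) = m+n≤o⇒m≤o∸n (toℕ y) (≤-trans (≤-reflexive (+-comm (toℕ y) (toℕ x))) (Equivalence.from ≤p⇔<p+1 x+y<p+1))
    from : ∀ y → toℕ y ≤ p ∸ toℕ x → InS∖0 (x , y)
    from y y≤p∸x = Equivalence.to ≤p⇔<p+1 (≤-trans (≤-reflexive (+-comm (toℕ x) (toℕ y))) (m≤o∸n⇒m+n≤o (toℕ y) (<⇒≤ (Fin.toℕ<n x)) y≤p∸x))
                 , λ (x≡0 , _) → x≢0 x≡0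

  slice₀-size : ∀ x → toℕ x ≡ 0 → suc (∑[ y < p ] χ (S∖0 (x , y))) ≡ p
  slice₀-size x x≡0 = count-nonzero (λ y → S∖0 (x , y)) (λ y y≡0 h → proj₂ (toWitness h) (x≡0 , y≡0))
    λ y y≢0 → fromWitness (Equivalence.to ≤p⇔<p+1 (≤-trans (≤-reflexive (cong (_+ toℕ y) x≡0)) (<⇒≤ (Fin.toℕ<n y))) , λ (_ , y≡0) → y≢0 y≡0)

  S∖0-size : 2 * # S∖0 + 4 ≡ p * p + 3 * p
  S∖0-size = +-cancelʳ-≡ (p * p) (2 * N + 4) (p * p + 3 * p) (begin
    2 * N + 4 + p * p                 ≡⟨ cong ((2 * N + 4) +_) (sym (∑-toℕ p)) ⟩
    2 * N + 4 + (2 * Σx + p)          ≡⟨ regroup N Σx p ⟩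
    2 * (N + Σx + 2) + p              ≡⟨ cong (λ s → 2 * s + p) rows ⟩
    2 * (p * suc p) + p               ≡⟨ expand p ⟩
    p * p + 3 * p + p * p             ∎)
    where
    open ≡-Reasoning
    N = # S∖0
    Σx = ∑[ x < p ] toℕ x
    r : Fin p → ℕ
    r x = ∑[ y < p ] χ (S∖0 (x , y))
    δ : Fin p → ℕ
    δ x = 2 * χ ⌊ toℕ x ≟ 0 ⌋
    row-total : ∀ x → r x + toℕ x + δ x ≡ suc p
    row-total x = case toℕ x ≟ 0 of λ where
      (yes x≡0) → begin
        r x + toℕ x + δ x     ≡⟨ cong₂ (λ t d → r x + t + 2 * d) x≡0 (χ-T {⌊ toℕ x ≟ 0 ⌋} (fromWitness x≡0)) ⟩
        r x + 0 + 2           ≡⟨ +-comm (r x + 0) 2 ⟩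
        suc (suc (r x + 0))   ≡⟨ cong (λ k → suc (suc k)) (+-identityʳ (r x)) ⟩
        suc (suc (r x))       ≡⟨ cong suc (slice₀-size x x≡0) ⟩
        suc p                 ∎
      (no x≢0) → begin
        r x + toℕ x + δ x     ≡⟨ cong (λ d → r x + toℕ x + 2 * d) (χ-F {⌊ toℕ x ≟ 0 ⌋} (λ h → x≢0 (toWitness h))) ⟩
        r x + toℕ x + 0       ≡⟨ +-identityʳ _ ⟩
        r x + toℕ x           ≡⟨ cong (_+ toℕ x) (slice-size x x≢0) ⟩
        suc (p ∸ toℕ x + toℕ x) ≡⟨ cong suc (m∸n+n≡m (<⇒≤ (Fin.toℕ<n x))) ⟩
        suc p                 ∎
    rows : N + Σx + 2 ≡ p * suc p
    rows = begin
      N + Σx + 2                                  ≡⟨ cong ((N + Σx) +_) (sym (trans (∑-*ˡ {p} 2 (λ x → χ ⌊ toℕ x ≟ 0 ⌋)) (cong (2 *_) count-zero))) ⟩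
      N + Σx + ∑[ x < p ] δ x                     ≡⟨ sym (trans (∑-distrib-+ {p} (λ x → r x + toℕ x) δ) (cong (_+ ∑[ x < p ] δ x) (∑-distrib-+ {p} r toℕ))) ⟩
      ∑[ x < p ] (r x + toℕ x + δ x)              ≡⟨ sum-cong-≗ row-total ⟩
      ∑[ x < p ] suc p                            ≡⟨ ∑-const p (suc p) ⟩
      p * suc p                                   ∎
    regroup : ∀ n t p → 2 * n + 4 + (2 * t + p) ≡ 2 * (n + t + 2) + p
    regroup = solve-∀
    expand : ∀ p → 2 * (p * suc p) + p ≡ p * p + 3 * p + p * p
    expand = solve-∀

  record Generic (e : Equation) : Set where
    open Equation e
    field
      p∤a   : ¬ (ℤ.+ p ∣ ℤ.+ a)
      p∤b   : ¬ (ℤ.+ p ∣ ℤ.+ b)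
      p∤a-b : ¬ (ℤ.+ p ∣ ℤ.+ a ℤ.- ℤ.+ b)

  mod-cases : ∀ m → m < p + p → m ≡ m % p ⊎ m ≡ p + m % p
  mod-cases m m<2p with p ≤? m
  ... | no  p≰m = inj₁ (sym (m<n⇒m%n≡m (≰⇒> p≰m)))
  ... | yes p≤m = inj₂ (begin
    m                    ≡⟨ sym (m∸n+n≡m p≤m) ⟩
    m ∸ p + p            ≡⟨ +-comm (m ∸ p) p ⟩
    p + (m ∸ p)          ≡⟨ cong (p +_) (sym (m<n⇒m%n≡m (m<n+o⇒m∸n<o m p m<2p))) ⟩
    p + (m ∸ p) % p      ≡⟨ cong (p +_) (sym ([m+n]%n≡m%n (m ∸ p) p)) ⟩
    p + (m ∸ p + p) % p  ≡⟨ cong (λ k → p + k % p) (m∸n+n≡m p≤m) ⟩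
    p + m % p            ∎)
    where open ≡-Reasoning

  wrap : ∀ m → m < p + p → m ≡ m % p + p * χ ⌊ p ≤? m ⌋
  wrap m m<2p with p ≤? m | mod-cases m m<2p
  ... | no  _   | inj₁ m≡m%p   = trans m≡m%p (sym (trans (cong (m % p +_) (*-zeroʳ p)) (+-identityʳ _)))
  ... | yes _   | inj₂ m≡p+m%p = trans m≡p+m%p (trans (+-comm p _) (cong (m % p +_) (sym (*-identityʳ p))))
  ... | no  p≰m | inj₂ m≡p+m%p = contradiction (≤-trans (m≤m+n p _) (≤-reflexive (sym m≡p+m%p))) p≰m
  ... | yes p≤m | inj₁ m≡m%p   = contradiction (≤-trans p≤m (≤-reflexive m≡m%p)) (<⇒≱ (m%n<n m p))

  module GenericGraph {e : Equation} (generic : Generic e) where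

    open Generic generic
    open Graph e p∤b public

    level : Fin p → ℕ
    level x = toℕ x + toℕ (graph x)

    residue : Fin p → Fin p
    residue x = fromℕ< (m%n<n (level x) p)

    graph-injective : ∀ {x x′} → graph x ≡ graph x′ → x ≡ x′
    graph-injective {x} {x′} eq = cong proj₁ (transversal-unique (transversal-row {e} {toℕ (graph x)} {Fin.toℕ<n _} p∤a)
      (graph-∈ x) (Equivalence.from ∈-row refl) (graph-∈ x′) (Equivalence.from ∈-row (cong toℕ (sym eq))))

    residue-injective : ∀ {x x′} → residue x ≡ residue x′ → x ≡ x′
    residue-injective {x} {x′} eq = cong proj₁ (transversal-unique (transversal-antidiagonal {e} {level x % p} {m%n<n (level x) p} p∤a-b)
      (graph-∈ x) (Equivalence.from ∈-antidiagonal refl) (graph-∈ x′)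
      (Equivalence.from ∈-antidiagonal (sym (trans (sym (Fin.toℕ-fromℕ< _)) (trans (cong toℕ eq) (Fin.toℕ-fromℕ< _))))))

    wrapped : ℕ
    wrapped = ∑[ x < p ] χ ⌊ p ≤? level x ⌋

    -- x, graph x and level x % p each run through all of Fin p, so the sum of the
    -- levels is both 2 ∑ x and ∑ x + p · wrapped.
    2*wrapped+1≡p : 2 * wrapped + 1 ≡ p
    2*wrapped+1≡p = *-cancelˡ-≡ (2 * wrapped + 1) p p (begin
      p * (2 * wrapped + 1)  ≡⟨ expand p wrapped ⟩
      2 * (p * wrapped) + p  ≡⟨ cong (λ t → 2 * t + p) (sym Σx≡p*wrapped) ⟩
      2 * Σx + p             ≡⟨ ∑-toℕ p ⟩
      p * p                  ∎)
      where
      open ≡-Reasoning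
      Σx : ℕ
      Σx = ∑[ x < p ] toℕ x
      expand : ∀ p w → p * (2 * w + 1) ≡ 2 * (p * w) + p
      expand = solve-∀
      residues : ∑[ x < p ] (level x % p) ≡ Σx
      residues = trans (sum-cong-≗ λ x → sym (Fin.toℕ-fromℕ< (m%n<n (level x) p))) (∑-reindex residue-injective toℕ)
      Σx≡p*wrapped : Σx ≡ p * wrapped
      Σx≡p*wrapped = +-cancelˡ-≡ Σx Σx (p * wrapped) (begin
        Σx + Σx                                           ≡⟨ cong (Σx +_) (sym (∑-reindex graph-injective toℕ)) ⟩
        Σx + ∑[ x < p ] toℕ (graph x)                     ≡⟨ sym (∑-distrib-+ {p} toℕ (toℕ ∘ graph)) ⟩
        ∑[ x < p ] level x                                  ≡⟨ sum-cong-≗ (λ x → wrap (level x) (+-mono-< (Fin.toℕ<n x) (Fin.toℕ<n (graph x)))) ⟩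
        ∑[ x < p ] (level x % p + p * χ ⌊ p ≤? level x ⌋)     ≡⟨ ∑-distrib-+ {p} (λ x → level x % p) (λ x → p * χ ⌊ p ≤? level x ⌋) ⟩
        ∑[ x < p ] (level x % p) + ∑[ x < p ] (p * χ ⌊ p ≤? level x ⌋)
                                                          ≡⟨ cong₂ _+_ residues (∑-*ˡ {p} p (λ x → χ ⌊ p ≤? level x ⌋)) ⟩
        Σx + p * wrapped                                  ∎)

    level≡p-at-most-once : ∑[ x < p ] χ ⌊ level x ≟ p ⌋ ≤ 1
    level≡p-at-most-once = count-atMostOne (λ x → ⌊ level x ≟ p ⌋) λ x x′ hx hx′ → residue-injective (Fin.toℕ-injective
      (trans (Fin.toℕ-fromℕ< _) (trans (cong (_% p) (trans (toWitness hx) (sym (toWitness hx′)))) (sym (Fin.toℕ-fromℕ< _)))))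

    unwrapped+wrapped≡p : ∑[ x < p ] χ ⌊ level x <? p ⌋ + wrapped ≡ p
    unwrapped+wrapped≡p = trans (sym (∑-distrib-+ {p} (λ x → χ ⌊ level x <? p ⌋) (λ x → χ ⌊ p ≤? level x ⌋)))
      (trans (sum-cong-≗ λ x → dichotomy (level x)) (trans (∑-const p 1) (*-identityʳ p)))
      where
      dichotomy : ∀ m → χ ⌊ m <? p ⌋ + χ ⌊ p ≤? m ⌋ ≡ 1
      dichotomy m with m <? p | p ≤? m
      ... | yes m<p | yes p≤m = contradiction p≤m (<⇒≱ m<p)
      ... | yes _   | no  _   = refl
      ... | no  _   | yes _   = refl
      ... | no  m≮p | no  p≰m = contradiction (≮⇒≥ m≮p) p≰m

  generic-size : ∀ {e} → Generic e → 2 * # (⟦ e ⟧ ∩ S∖0) ≤ p + 3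
  generic-size {e} generic = begin
    2 * # (⟦ e ⟧ ∩ S∖0)                                             ≡⟨ cong (2 *_) (#-along S∖0) ⟩
    2 * ∑[ x < p ] χ (S∖0 (x , graph x))                            ≤⟨ *-monoʳ-≤ 2 (∑-mono-≤ in-S∖0) ⟩
    2 * ∑[ x < p ] (χ ⌊ level x <? p ⌋ + χ ⌊ level x ≟ p ⌋)             ≡⟨ cong (2 *_) (∑-distrib-+ {p} (λ x → χ ⌊ level x <? p ⌋) (λ x → χ ⌊ level x ≟ p ⌋)) ⟩
    2 * (unwrapped + ∑[ x < p ] χ ⌊ level x ≟ p ⌋)                    ≤⟨ *-monoʳ-≤ 2 (+-monoʳ-≤ unwrapped level≡p-at-most-once) ⟩
    2 * (unwrapped + 1)                                             ≡⟨ +-cancelʳ-≡ p (2 * (unwrapped + 1)) (p + 3) count ⟩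
    p + 3                                                           ∎
    where
    open ≤-Reasoning
    open GenericGraph generic
    unwrapped : ℕ
    unwrapped = ∑[ x < p ] χ ⌊ level x <? p ⌋
    in-S∖0 : ∀ x → χ (S∖0 (x , graph x)) ≤ χ ⌊ level x <? p ⌋ + χ ⌊ level x ≟ p ⌋
    in-S∖0 x = χ-⊎ (S∖0 (x , graph x)) ⌊ level x <? p ⌋ ⌊ level x ≟ p ⌋ λ h →
      Sum.map fromWitness fromWitness (m≤n⇒m<n∨m≡n (Equivalence.from ≤p⇔<p+1 (proj₁ (toWitness h))))
    count : 2 * (unwrapped + 1) + p ≡ p + 3 + p
    count = begin-equality
      2 * (unwrapped + 1) + p                  ≡⟨ cong (2 * (unwrapped + 1) +_) (sym 2*wrapped+1≡p) ⟩
      2 * (unwrapped + 1) + (2 * wrapped + 1)  ≡⟨ regroup unwrapped wrapped ⟩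
      2 * (unwrapped + wrapped) + 3            ≡⟨ cong (λ t → 2 * t + 3) unwrapped+wrapped≡p ⟩
      2 * p + 3                                ≡⟨ regroup′ p ⟩
      p + 3 + p                                ∎
      where
      regroup : ∀ u w → 2 * (u + 1) + (2 * w + 1) ≡ 2 * (u + w) + 3
      regroup = solve-∀
      regroup′ : ∀ p → 2 * p + 3 ≡ p + 3 + p
      regroup′ = solve-∀

module TestLines (p : ℕ) {{_ : NonZero p}} (prime : Prime p) (5≤p : 5 ≤ p) where

  open Congruence p prime using (0<n<p⇒p∤n)
  open Lines p prime
  open Staircase p prime
  open Equivalence using (to; from)

  0<p : 0 < p
  0<p = >-nonZero⁻¹ p

  1<p : 1 < p
  1<p = ≤-trans (s≤s (s≤s z≤n)) 5≤p

  p∸1<p : p ∸ 1 < p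
  p∸1<p = ∸-monoʳ-< (s≤s z≤n) (<⇒≤ 1<p)

  row₀ row₁ column₀ column₁ antidiagonal₀ antidiagonal₋₁ : Equation
  row₀           = row 0 0<p
  row₁           = row 1 1<p
  column₀        = column 0 0<p
  column₁        = column 1 1<p
  antidiagonal₀  = antidiagonal 0 0<p
  antidiagonal₋₁ = antidiagonal (p ∸ 1) p∸1<p

  p∤1 : ¬ (ℤ.+ p ∣ ℤ.+ 1)
  p∤1 = 0<n<p⇒p∤n (s≤s z≤n) 1<p

  NotOrigin : Point p → Set
  NotOrigin (x , y) = ¬ (toℕ x ≡ 0 × toℕ y ≡ 0)

  OffOrigin⊆S∖0 : Equation → Set
  OffOrigin⊆S∖0 M = ∀ z → T (⟦ M ⟧ z) → NotOrigin z → T (S∖0 z)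

  ∈ₑ-origin : ∀ {e} {x y : Fin p} → (x , y) ∈ₑ e → toℕ x ≡ 0 → toℕ y ≡ 0 → Equation.c e ≡ 0
  ∈ₑ-origin {e} {x} {y} (on eval≡c) x≡0 y≡0 = begin
    Equation.c e                                              ≡⟨ sym eval≡c ⟩
    (Equation.a e * toℕ x + Equation.b e * toℕ y) % p         ≡⟨ cong₂ (λ u v → (Equation.a e * u + Equation.b e * v) % p) x≡0 y≡0 ⟩
    (Equation.a e * 0 + Equation.b e * 0) % p                 ≡⟨ cong (_% p) (cong₂ _+_ (*-zeroʳ (Equation.a e)) (*-zeroʳ (Equation.b e))) ⟩
    0 % p                                                     ≡⟨ m<n⇒m%n≡m 0<p ⟩
    0                                                         ∎
    where open ≡-Reasoning

  meets-once : ∀ {e M} → Transversal e M → Equation.c e ≢ 0 → OffOrigin⊆S∖0 M → # ((⟦ e ⟧ ∩ S∖0) ∩ ⟦ M ⟧) ≡ 1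
  meets-once {e} {M} t c≢0 M⊆S = trans (#-∩-absorb ⟦ e ⟧ S∖0 ⟦ M ⟧ λ z z∈e z∈M → M⊆S z z∈M λ (x≡0 , y≡0) → c≢0 (∈ₑ-origin (toWitness z∈e) x≡0 y≡0))
    (transversal-meet t)

  S∖0-intro : ∀ {x y : Fin p} → toℕ x + toℕ y ≤ p → NotOrigin (x , y) → T (S∖0 (x , y))
  S∖0-intro x+y≤p nonzero = fromWitness (to ≤p⇔<p+1 x+y≤p , nonzero)

  row₁⊆S∖0 : OffOrigin⊆S∖0 row₁
  row₁⊆S∖0 (x , y) on-row₁ nonzero = S∖0-intro (≤-trans (≤-reflexive (trans (cong (toℕ x +_) (to ∈-row (toWitness on-row₁))) (+-comm (toℕ x) 1))) (Fin.toℕ<n x)) nonzero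

  row₀⊆S∖0 : OffOrigin⊆S∖0 row₀
  row₀⊆S∖0 (x , y) y≡0 nonzero = S∖0-intro (≤-trans (≤-reflexive (trans (cong (toℕ x +_) (to ∈-row (toWitness y≡0))) (+-identityʳ (toℕ x)))) (<⇒≤ (Fin.toℕ<n x))) nonzero

  column₁⊆S∖0 : OffOrigin⊆S∖0 column₁
  column₁⊆S∖0 (x , y) x≡1 nonzero = S∖0-intro (≤-trans (≤-reflexive (cong (_+ toℕ y) (to ∈-column (toWitness x≡1)))) (Fin.toℕ<n y)) nonzero

  column₀⊆S∖0 : OffOrigin⊆S∖0 column₀
  column₀⊆S∖0 (x , y) x≡0 nonzero = S∖0-intro (≤-trans (≤-reflexive (cong (_+ toℕ y) (to ∈-column (toWitness x≡0)))) (<⇒≤ (Fin.toℕ<n y))) nonzero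

  antidiagonal-sum : ∀ {x y : Fin p} {c} → (toℕ x + toℕ y) % p ≡ c → toℕ x + toℕ y ≡ c ⊎ toℕ x + toℕ y ≡ p + c
  antidiagonal-sum {x} {y} eq = subst (λ r → toℕ x + toℕ y ≡ r ⊎ toℕ x + toℕ y ≡ p + r) eq
    (mod-cases (toℕ x + toℕ y) (+-mono-< (Fin.toℕ<n x) (Fin.toℕ<n y)))

  antidiagonal₋₁⊆S∖0 : OffOrigin⊆S∖0 antidiagonal₋₁
  antidiagonal₋₁⊆S∖0 (x , y) h nonzero with antidiagonal-sum {x} {y} (to ∈-antidiagonal (toWitness h))
  ... | inj₁ x+y≡p-1 = S∖0-intro (≤-trans (≤-reflexive x+y≡p-1) (m∸n≤m p 1)) nonzero
  ... | inj₂ x+y≡2p-1 = contradiction (≤-trans (≤-reflexive too-big) (+-mono-≤ (Fin.toℕ<n x) (Fin.toℕ<n y))) (1+n≰n {p + p})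
    where
    too-big : suc (p + p) ≡ suc (toℕ x) + suc (toℕ y)
    too-big = begin
      suc (p + p)                  ≡⟨ cong (λ k → suc (p + k)) (sym (m∸n+n≡m (<⇒≤ 1<p))) ⟩
      suc (p + (p ∸ 1 + 1))        ≡⟨ cong suc (sym (+-assoc p (p ∸ 1) 1)) ⟩
      suc (p + (p ∸ 1) + 1)        ≡⟨ cong (λ k → suc (k + 1)) (sym x+y≡2p-1) ⟩
      suc (toℕ x + toℕ y + 1)      ≡⟨ cong suc (trans (+-assoc (toℕ x) (toℕ y) 1) (cong (toℕ x +_) (+-comm (toℕ y) 1))) ⟩
      suc (toℕ x + suc (toℕ y))    ∎
      where open ≡-Reasoning

  antidiagonal₀⊆S∖0 : OffOrigin⊆S∖0 antidiagonal₀
  antidiagonal₀⊆S∖0 (x , y) h nonzero with antidiagonal-sum {x} {y} (to ∈-antidiagonal (toWitness h))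
  ... | inj₁ x+y≡0 = contradiction (m+n≡0⇒m≡0 (toℕ x) x+y≡0 , m+n≡0⇒n≡0 (toℕ x) x+y≡0) nonzero
  ... | inj₂ x+y≡p = S∖0-intro (≤-reflexive (trans x+y≡p (+-identityʳ p))) nonzero

  off-origin : ∀ {e z} → z ∈ₑ e → Equation.c e ≢ 0 → NotOrigin z
  off-origin z∈e c≢0 (x≡0 , y≡0) = c≢0 (∈ₑ-origin z∈e x≡0 y≡0)

  1≢0 : 1 ≢ 0
  1≢0 ()

  p∸1≢0 : p ∸ 1 ≢ 0
  p∸1≢0 = m>n⇒m∸n≢0 1<p

  row₁-size : # (S∖0 ∩ ⟦ row₁ ⟧) ≡ p
  row₁-size = trans (#-∩-comm S∖0 ⟦ row₁ ⟧) (trans (#-along S∖0)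
    (count-all _ λ x → row₁⊆S∖0 _ (fromWitness (graph-∈ x)) (off-origin (graph-∈ x) 1≢0)))
    where open Graph row₁ p∤1

  row₀-size : suc (# (S∖0 ∩ ⟦ row₀ ⟧)) ≡ p
  row₀-size = trans (cong suc (trans (#-∩-comm S∖0 ⟦ row₀ ⟧) (#-along S∖0)))
    (count-nonzero _ (λ x x≡0 h → proj₂ (toWitness h) (x≡0 , to ∈-row (graph-∈ x)))
                     (λ x x≢0 → row₀⊆S∖0 _ (fromWitness (graph-∈ x)) λ (x≡0 , _) → x≢0 x≡0))
    where open Graph row₀ p∤1

  antidiagonal₋₁-size : # (S∖0 ∩ ⟦ antidiagonal₋₁ ⟧) ≡ p
  antidiagonal₋₁-size = trans (#-∩-comm S∖0 ⟦ antidiagonal₋₁ ⟧) (trans (#-along S∖0)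
    (count-all _ λ x → antidiagonal₋₁⊆S∖0 _ (fromWitness (graph-∈ x)) (off-origin (graph-∈ x) p∸1≢0)))
    where open Graph antidiagonal₋₁ p∤1

  antidiagonal₀-size : suc (# (S∖0 ∩ ⟦ antidiagonal₀ ⟧)) ≡ p
  antidiagonal₀-size = trans (cong suc (trans (#-∩-comm S∖0 ⟦ antidiagonal₀ ⟧) (#-along S∖0)))
    (count-nonzero _ (λ x x≡0 h → proj₂ (toWitness h) (x≡0 , graph-zero x x≡0))
                     (λ x x≢0 → antidiagonal₀⊆S∖0 _ (fromWitness (graph-∈ x)) λ (x≡0 , _) → x≢0 x≡0))
    where
    open Graph antidiagonal₀ p∤1
    graph-zero : ∀ x → toℕ x ≡ 0 → toℕ (graph x) ≡ 0
    graph-zero x x≡0 = trans (sym (m<n⇒m%n≡m (Fin.toℕ<n (graph x))))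
      (trans (cong (λ k → (k + toℕ (graph x)) % p) (sym x≡0)) (to ∈-antidiagonal (graph-∈ x)))

  column-size : ∀ c c<p → # (S∖0 ∩ ⟦ column c c<p ⟧) ≡ # (S∖0 ∩ ⟦ row c c<p ⟧)
  column-size c c<p = #-transpose (S∖0 ∩ ⟦ column c c<p ⟧) (S∖0 ∩ ⟦ row c c<p ⟧) λ (x , y) →
    cong₂ _∧_ (⌊⌋-cong (InS∖0? (x , y)) (InS∖0? (y , x)) (transpose-S x y) (transpose-S y x))
              (⌊⌋-cong ((x , y) ∈ₑ? column c c<p) ((y , x) ∈ₑ? row c c<p) (from ∈-row ∘ to ∈-column) (from ∈-column ∘ to ∈-row))
    where
    transpose-S : ∀ x y → InS∖0 (x , y) → InS∖0 (y , x)
    transpose-S x y (x+y<p+1 , nonzero) = subst (_< p + 1) (+-comm (toℕ x) (toℕ y)) x+y<p+1 , λ (y≡0 , x≡0) → nonzero (x≡0 , y≡0)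

  record TestLine (M : Equation) : Set where
    field
      in-S∖0      : OffOrigin⊆S∖0 M
      transversal-to-generic : ∀ {e} → Generic e → Transversal e M

  test-row₀ : TestLine row₀
  test-row₀ = record { in-S∖0 = row₀⊆S∖0 ; transversal-to-generic = transversal-row ∘ Generic.p∤a }

  test-row₁ : TestLine row₁
  test-row₁ = record { in-S∖0 = row₁⊆S∖0 ; transversal-to-generic = transversal-row ∘ Generic.p∤a }

  test-column₀ : TestLine column₀
  test-column₀ = record { in-S∖0 = column₀⊆S∖0 ; transversal-to-generic = transversal-column ∘ Generic.p∤b }

  test-column₁ : TestLine column₁
  test-column₁ = record { in-S∖0 = column₁⊆S∖0 ; transversal-to-generic = transversal-column ∘ Generic.p∤b }

  test-antidiagonal₀ : TestLine antidiagonal₀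
  test-antidiagonal₀ = record { in-S∖0 = antidiagonal₀⊆S∖0 ; transversal-to-generic = transversal-antidiagonal ∘ Generic.p∤a-b }

  test-antidiagonal₋₁ : TestLine antidiagonal₋₁
  test-antidiagonal₋₁ = record { in-S∖0 = antidiagonal₋₁⊆S∖0 ; transversal-to-generic = transversal-antidiagonal ∘ Generic.p∤a-b }

  generic-meets-once : ∀ {e M} → TestLine M → Generic e → Equation.c e ≢ 0 → # ((⟦ e ⟧ ∩ S∖0) ∩ ⟦ M ⟧) ≡ 1
  generic-meets-once test generic c≢0 = meets-once (TestLine.transversal-to-generic test generic) c≢0 (TestLine.in-S∖0 test)

  generic-meets-triangle : ∀ {e M₁ M₂ M₃} → TestLine M₁ → TestLine M₂ → TestLine M₃ →
    NoTriplePoint S∖0 ⟦ M₁ ⟧ ⟦ M₂ ⟧ ⟦ M₃ ⟧ → Generic e → Equation.c e ≢ 0 →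
    2 ≤ # ((⟦ e ⟧ ∩ S∖0) ∩ (⟦ M₁ ⟧ ∪ ⟦ M₂ ⟧ ∪ ⟦ M₃ ⟧))
  generic-meets-triangle {e} {M₁} {M₂} {M₃} t₁ t₂ t₃ no-triple generic c≢0 = half (begin
    3                                                                        ≡⟨ sym (cong₂ _+_ (cong₂ _+_ (meets t₁) (meets t₂)) (meets t₃)) ⟩
    # ((⟦ e ⟧ ∩ S∖0) ∩ ⟦ M₁ ⟧) + # ((⟦ e ⟧ ∩ S∖0) ∩ ⟦ M₂ ⟧) + # ((⟦ e ⟧ ∩ S∖0) ∩ ⟦ M₃ ⟧)
                                                                             ≤⟨ #-∪₃-half (⟦ e ⟧ ∩ S∖0) ⟦ M₁ ⟧ ⟦ M₂ ⟧ ⟦ M₃ ⟧ no-triple-on-e ⟩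
    2 * # ((⟦ e ⟧ ∩ S∖0) ∩ (⟦ M₁ ⟧ ∪ ⟦ M₂ ⟧ ∪ ⟦ M₃ ⟧))                       ∎)
    where
    open ≤-Reasoning
    meets : ∀ {M} → TestLine M → # ((⟦ e ⟧ ∩ S∖0) ∩ ⟦ M ⟧) ≡ 1
    meets t = generic-meets-once t generic c≢0
    no-triple-on-e : NoTriplePoint (⟦ e ⟧ ∩ S∖0) ⟦ M₁ ⟧ ⟦ M₂ ⟧ ⟦ M₃ ⟧
    no-triple-on-e z h = no-triple z (T-∧ʳ (⟦ e ⟧ z) h)
    half : ∀ {n} → 3 ≤ 2 * n → 2 ≤ n
    half {suc (suc n)} _ = s≤s (s≤s z≤n)
    half {suc zero} (s≤s (s≤s ()))

  no-triple-point : ∀ {i j k i<p j<p k<p} → (i + j) % p ≢ k →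
    NoTriplePoint S∖0 ⟦ row j j<p ⟧ ⟦ column i i<p ⟧ ⟦ antidiagonal k k<p ⟧
  no-triple-point {i} {j} {k} i+j≢k (x , y) _ on-row on-column on-antidiagonal = i+j≢k (begin
    (i + j) % p                ≡⟨ cong₂ (λ u v → (u + v) % p) (sym (to ∈-column (toWitness on-column))) (sym (to ∈-row (toWitness on-row))) ⟩
    (toℕ x + toℕ y) % p        ≡⟨ to ∈-antidiagonal (toWitness on-antidiagonal) ⟩
    k                          ∎)
    where open ≡-Reasoning

  meeting-point : ∀ {A B} z → T (S∖0 z) → z ∈ₑ A → z ∈ₑ B → 1 ≤ # (S∖0 ∩ ⟦ A ⟧ ∩ ⟦ B ⟧)
  meeting-point {A} {B} z in-S on-A on-B = #-witness (S∖0 ∩ ⟦ A ⟧ ∩ ⟦ B ⟧) {z}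
    (T-∧-intro {S∖0 z} in-S (T-∧-intro {⟦ A ⟧ z} (fromWitness on-A) (fromWitness on-B)))

  row₀∩column₀ : # (S∖0 ∩ ⟦ row₀ ⟧ ∩ ⟦ column₀ ⟧) ≡ 0
  row₀∩column₀ = #-empty _ λ z h →
    let (in-S , on-row , on-column) = T-∧₃ (S∖0 z) (⟦ row₀ ⟧ z) (⟦ column₀ ⟧ z) h
    in proj₂ (toWitness in-S) (to ∈-column (toWitness on-column) , to ∈-row (toWitness on-row))

  on-axis-antidiagonal₀ : ∀ (x y : Fin p) → toℕ y ≡ 0 → (toℕ x + toℕ y) % p ≡ 0 → toℕ x ≡ 0
  on-axis-antidiagonal₀ x y y≡0 x+y≡0 = begin
    toℕ x                  ≡⟨ sym (m<n⇒m%n≡m (Fin.toℕ<n x)) ⟩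
    toℕ x % p              ≡⟨ cong (_% p) (sym (+-identityʳ (toℕ x))) ⟩
    (toℕ x + 0) % p        ≡⟨ cong (λ k → (toℕ x + k) % p) (sym y≡0) ⟩
    (toℕ x + toℕ y) % p    ≡⟨ x+y≡0 ⟩
    0                      ∎
    where open ≡-Reasoning

  row₀∩antidiagonal₀ : # (S∖0 ∩ ⟦ row₀ ⟧ ∩ ⟦ antidiagonal₀ ⟧) ≡ 0
  row₀∩antidiagonal₀ = #-empty _ λ (x , y) h →
    let (in-S , on-row , on-antidiagonal) = T-∧₃ (S∖0 (x , y)) (⟦ row₀ ⟧ (x , y)) (⟦ antidiagonal₀ ⟧ (x , y)) h
        y≡0 = to ∈-row (toWitness on-row)
    in proj₂ (toWitness in-S) (on-axis-antidiagonal₀ x y y≡0 (to ∈-antidiagonal (toWitness on-antidiagonal)) , y≡0)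

  column₀∩antidiagonal₀ : # (S∖0 ∩ ⟦ column₀ ⟧ ∩ ⟦ antidiagonal₀ ⟧) ≡ 0
  column₀∩antidiagonal₀ = #-empty _ λ (x , y) h →
    let (in-S , on-column , on-antidiagonal) = T-∧₃ (S∖0 (x , y)) (⟦ column₀ ⟧ (x , y)) (⟦ antidiagonal₀ ⟧ (x , y)) h
        x≡0 = to ∈-column (toWitness on-column)
    in proj₂ (toWitness in-S) (x≡0 , on-axis-antidiagonal₀ y x x≡0 (trans (cong (_% p) (+-comm (toℕ y) (toℕ x))) (to ∈-antidiagonal (toWitness on-antidiagonal))))

  generic-meets-star : ∀ {e} → Generic e → Equation.c e ≢ 0 →
    # ((⟦ e ⟧ ∩ S∖0) ∩ (⟦ row₀ ⟧ ∪ ⟦ column₀ ⟧ ∪ ⟦ antidiagonal₀ ⟧)) ≡ 3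
  generic-meets-star {e} generic c≢0 = trans
    (#-∪₃-disjoint (⟦ e ⟧ ∩ S∖0) ⟦ row₀ ⟧ ⟦ column₀ ⟧ ⟦ antidiagonal₀ ⟧ (on-e {⟦ row₀ ⟧} {⟦ column₀ ⟧} row₀∩column₀) (on-e {⟦ row₀ ⟧} {⟦ antidiagonal₀ ⟧} row₀∩antidiagonal₀) (on-e {⟦ column₀ ⟧} {⟦ antidiagonal₀ ⟧} column₀∩antidiagonal₀))
    (cong₂ _+_ (cong₂ _+_ (meets test-row₀) (meets test-column₀)) (meets test-antidiagonal₀))
    where
    meets : ∀ {M} → TestLine M → # ((⟦ e ⟧ ∩ S∖0) ∩ ⟦ M ⟧) ≡ 1
    meets t = generic-meets-once t generic c≢0
    on-e : ∀ {A B} → # (S∖0 ∩ A ∩ B) ≡ 0 → # ((⟦ e ⟧ ∩ S∖0) ∩ A ∩ B) ≡ 0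
    on-e {A} {B} empty = n≤0⇒n≡0 (≤-trans (#-mono {P = (⟦ e ⟧ ∩ S∖0) ∩ A ∩ B} {Q = S∖0 ∩ A ∩ B}
      λ z h → T-∧-intro (T-∧ʳ (⟦ e ⟧ z) (T-∧ˡ (⟦ e ⟧ z ∧ S∖0 z) h)) (T-∧ʳ (⟦ e ⟧ z ∧ S∖0 z) h)) (≤-reflexive empty))

  star-size : # (S∖0 ∩ (⟦ row₀ ⟧ ∪ ⟦ column₀ ⟧ ∪ ⟦ antidiagonal₀ ⟧)) + 3 ≡ 3 * p
  star-size = begin
    # (S∖0 ∩ (⟦ row₀ ⟧ ∪ ⟦ column₀ ⟧ ∪ ⟦ antidiagonal₀ ⟧)) + 3
      ≡⟨ cong (_+ 3) (#-∪₃-disjoint S∖0 ⟦ row₀ ⟧ ⟦ column₀ ⟧ ⟦ antidiagonal₀ ⟧ row₀∩column₀ row₀∩antidiagonal₀ column₀∩antidiagonal₀) ⟩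
    # (S∖0 ∩ ⟦ row₀ ⟧) + # (S∖0 ∩ ⟦ column₀ ⟧) + # (S∖0 ∩ ⟦ antidiagonal₀ ⟧) + 3
      ≡⟨ regroup (# (S∖0 ∩ ⟦ row₀ ⟧)) (# (S∖0 ∩ ⟦ column₀ ⟧)) (# (S∖0 ∩ ⟦ antidiagonal₀ ⟧)) ⟩
    suc (# (S∖0 ∩ ⟦ row₀ ⟧)) + suc (# (S∖0 ∩ ⟦ column₀ ⟧)) + suc (# (S∖0 ∩ ⟦ antidiagonal₀ ⟧))
      ≡⟨ cong₂ _+_ (cong₂ _+_ row₀-size (trans (cong suc (column-size 0 0<p)) row₀-size)) antidiagonal₀-size ⟩
    p + p + p
      ≡⟨ triple p ⟩
    3 * p ∎
    where
    open ≡-Reasoning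
    regroup : ∀ a b c → a + b + c + 3 ≡ suc a + suc b + suc c
    regroup = solve-∀
    triple : ∀ p → p + p + p ≡ 3 * p
    triple = solve-∀

module Covering (p : ℕ) {{_ : NonZero p}} (prime : Prime p) (5≤p : 5 ≤ p) (L : List (Line p))
  (avoids : All (λ ℓ → toℕ (Line.c ℓ) ≢ 0) L)
  (covers : ∀ z → InS∖0 z → Any (z ∈L_) L)
  (short : length L ≤ p) where

  open Lines p prime
  open Staircase p prime
  open TestLines p prime 5≤p
  open Equivalence using (to; from)

  ⟪_⟫ : Line p → Point p → Bool
  ⟪ ℓ ⟫ = ⟦ eqn ℓ ⟧

  covering-bound : (Q : Point p → Bool) → (∀ z → T (Q z) → T (S∖0 z)) → # Q ≤ ∑[ ℓ ∈ L ] # (⟪ ℓ ⟫ ∩ Q)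
  covering-bound Q Q⊆S = union-bound L ⟪_⟫ Q λ z Qz → Any.map (fromWitness ∘ on) (covers z (toWitness (Q⊆S z Qz)))

  origin₀ : Point p
  origin₀ = fromℕ< 0<p , fromℕ< 0<p

  -- M₀ passes through the origin and M₁ is parallel to it.  Lines not parallel to them meet
  -- each once, parallel lines miss M₀, so with |L| ≤ p every parallel line of L meets M₁.
  module Direction (α β c₁ : ℕ) (c₁<p : c₁ < p) (nondegenerate : NonDegenerate (equation α β 0 0<p))
    (M₀-size : suc (# (S∖0 ∩ ⟦ equation α β 0 0<p ⟧)) ≡ p)
    (M₁-size : # (S∖0 ∩ ⟦ equation α β c₁ c₁<p ⟧) ≡ p) where

    M₀ M₁ : Equation
    M₀ = equation α β 0 0<p
    M₁ = equation α β c₁ c₁<p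

    parallel : Line p → Bool
    parallel ℓ = ⌊ ℤ.+ p ∣? det (eqn ℓ) M₀ ⌋

    meets-M₁ : Line p → Bool
    meets-M₁ ℓ = ⌊ meet? (eqn ℓ) M₁ ⌋

    origin₀∈M₀ : origin₀ ∈ₑ M₀
    origin₀∈M₀ = on (trans (cong₂ (λ u v → (α * u + β * v) % p) (Fin.toℕ-fromℕ< 0<p) (Fin.toℕ-fromℕ< 0<p))
      (trans (cong (_% p) (cong₂ _+_ (*-zeroʳ α) (*-zeroʳ β))) (m<n⇒m%n≡m 0<p)))

    parallel-misses-M₀ : ∀ ℓ → toℕ (Line.c ℓ) ≢ 0 → T (parallel ℓ) → # (⟪ ℓ ⟫ ∩ (S∖0 ∩ ⟦ M₀ ⟧)) ≡ 0
    parallel-misses-M₀ ℓ c≢0 par = #-empty _ λ z h →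
      c≢0 (∈ₑ-origin (parallel-⊆ p∣det nondegenerate (toWitness (T-∧ʳ (S∖0 z) (T-∧ʳ (⟪ ℓ ⟫ z) h))) (toWitness (T-∧ˡ (⟪ ℓ ⟫ z) h)) origin₀∈M₀)
        (Fin.toℕ-fromℕ< 0<p) (Fin.toℕ-fromℕ< 0<p))
      where
      p∣det : ℤ.+ p ∣ det M₀ (eqn ℓ)
      p∣det = subst (ℤ.+ p ∣_) (antisymmetric (ℤ.+ α) (ℤ.+ β) (ℤ.+ toℕ (Line.a ℓ)) (ℤ.+ toℕ (Line.b ℓ))) (∣m⇒∣-m (toWitness par))
        where
        antisymmetric : ∀ a b a′ b′ → ℤ.- (a′ ℤ.* b ℤ.- a ℤ.* b′) ≡ a ℤ.* b′ ℤ.- a′ ℤ.* b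
        antisymmetric = ℤ-Solver.solve-∀

    meets-at-most-once : ∀ ℓ {M} → Transversal (eqn ℓ) M → # (⟪ ℓ ⟫ ∩ (S∖0 ∩ ⟦ M ⟧)) ≤ 1
    meets-at-most-once ℓ {M} t = ≤-trans (#-mono λ z h → T-∧-intro (T-∧ˡ (⟪ ℓ ⟫ z) h) (T-∧ʳ (S∖0 z) (T-∧ʳ (⟪ ℓ ⟫ z) h)))
      (≤-reflexive (transversal-meet t))

    M₀-bound : ∀ ℓ → toℕ (Line.c ℓ) ≢ 0 → # (⟪ ℓ ⟫ ∩ (S∖0 ∩ ⟦ M₀ ⟧)) ≤ χ (not (parallel ℓ))
    M₀-bound ℓ c≢0 with parallel ℓ in par
    ... | true  = ≤-reflexive (parallel-misses-M₀ ℓ c≢0 (subst T (sym par) _))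
    ... | false = meets-at-most-once ℓ (transversal λ p∣det → subst T par (fromWitness p∣det))

    M₁-bound : ∀ ℓ → # (⟪ ℓ ⟫ ∩ (S∖0 ∩ ⟦ M₁ ⟧)) ≤ χ (not (parallel ℓ)) + p * χ (parallel ℓ ∧ meets-M₁ ℓ)
    M₁-bound ℓ with parallel ℓ in par | meets-M₁ ℓ in meets
    ... | false | _     = ≤-trans (meets-at-most-once ℓ (transversal λ p∣det → subst T par (fromWitness p∣det))) (m≤m+n 1 _)
    ... | true  | true  = ≤-trans (#-mono λ z h → T-∧ʳ (⟪ ℓ ⟫ z) h) (≤-reflexive (trans M₁-size (sym (*-identityʳ p))))
    ... | true  | false = ≤-trans (≤-reflexive (#-empty _ λ z h → subst T meets
      (fromWitness (z , toWitness (T-∧ˡ (⟪ ℓ ⟫ z) h) , toWitness (T-∧ʳ (S∖0 z) (T-∧ʳ (⟪ ℓ ⟫ z) h)))))) z≤n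

    private
      counting-contradiction : ∀ n k f → p ≤ suc n → n + k ≤ p → suc f ≤ k → p ≤ n + p * f → ⊥
      counting-contradiction n k zero    p≤1+n n+k≤p 1≤k p≤n+p*0 = 1+n≰n (begin
        suc n    ≡⟨ +-comm 1 n ⟩
        n + 1    ≤⟨ +-monoʳ-≤ n 1≤k ⟩
        n + k    ≤⟨ n+k≤p ⟩
        p        ≤⟨ p≤n+p*0 ⟩
        n + p * 0 ≡⟨ trans (cong (n +_) (*-zeroʳ p)) (+-identityʳ n) ⟩
        n        ∎)
        where open ≤-Reasoning
      counting-contradiction n k (suc f) p≤1+n n+k≤p 2≤k _ = 1+n≰n (begin
        suc (suc n) ≡⟨ +-comm 2 n ⟩
        n + 2       ≤⟨ +-monoʳ-≤ n (≤-trans (s≤s (s≤s z≤n)) 2≤k) ⟩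
        n + k       ≤⟨ n+k≤p ⟩
        p           ≤⟨ p≤1+n ⟩
        suc n       ∎)
        where open ≤-Reasoning

    non-parallel meeting : ℕ
    non-parallel = ∑[ ℓ ∈ L ] χ (not (parallel ℓ))
    meeting      = ∑[ ℓ ∈ L ] χ (parallel ℓ ∧ meets-M₁ ℓ)

    M₀-count : p ≤ suc non-parallel
    M₀-count = begin
      p                                            ≡⟨ sym M₀-size ⟩
      suc (# (S∖0 ∩ ⟦ M₀ ⟧))                       ≤⟨ s≤s (covering-bound (S∖0 ∩ ⟦ M₀ ⟧) (λ z → T-∧ˡ (S∖0 z))) ⟩
      suc (∑[ ℓ ∈ L ] # (⟪ ℓ ⟫ ∩ (S∖0 ∩ ⟦ M₀ ⟧)))  ≤⟨ s≤s (∑ₗ-mono-≤ (All.map (λ {ℓ} → M₀-bound ℓ) avoids)) ⟩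
      suc non-parallel                             ∎
      where open ≤-Reasoning

    M₁-count : p ≤ non-parallel + p * meeting
    M₁-count = begin
      p                                                                      ≡⟨ sym M₁-size ⟩
      # (S∖0 ∩ ⟦ M₁ ⟧)                                                       ≤⟨ covering-bound (S∖0 ∩ ⟦ M₁ ⟧) (λ z → T-∧ˡ (S∖0 z)) ⟩
      ∑[ ℓ ∈ L ] # (⟪ ℓ ⟫ ∩ (S∖0 ∩ ⟦ M₁ ⟧))                                   ≤⟨ ∑ₗ-mono-≤ (All.universal M₁-bound L) ⟩
      ∑[ ℓ ∈ L ] (χ (not (parallel ℓ)) + p * χ (parallel ℓ ∧ meets-M₁ ℓ))    ≡⟨ ∑ₗ-distrib-+ L _ _ ⟩
      non-parallel + ∑[ ℓ ∈ L ] (p * χ (parallel ℓ ∧ meets-M₁ ℓ))            ≡⟨ cong (non-parallel +_) (∑ₗ-*ˡ L p _) ⟩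
      non-parallel + p * meeting                                             ∎
      where open ≤-Reasoning

    parallel⇒meets-M₁ : All (λ ℓ → T (parallel ℓ) → T (meets-M₁ ℓ)) L
    parallel⇒meets-M₁ = All.map (λ {ℓ} → T-∧-not (parallel ℓ) (meets-M₁ ℓ)) (¬Any⇒All¬ L no-parallel-line-misses-M₁)
      where
      parallels : ℕ
      parallels = ∑[ ℓ ∈ L ] χ (parallel ℓ)
      no-parallel-line-misses-M₁ : ¬ Any (λ ℓ → T (parallel ℓ ∧ not (meets-M₁ ℓ))) L
      no-parallel-line-misses-M₁ misses = counting-contradiction non-parallel parallels meeting M₀-count
        (≤-trans (≤-reflexive (∑ₗ-χ-complement L parallel)) short)
        (≤-trans (≤-reflexive (+-comm 1 meeting)) (≤-trans (+-monoʳ-≤ meeting (∑ₗ-χ-any (λ ℓ → parallel ℓ ∧ not (meets-M₁ ℓ)) misses))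
          (≤-reflexive (sym (∑ₗ-χ-split L parallel meets-M₁)))))
        M₁-count

    parallel-⊆M₁ : ∀ ℓ → T (parallel ℓ) → T (meets-M₁ ℓ) → ∀ z → T (⟪ ℓ ⟫ z) → T (⟦ M₁ ⟧ z)
    parallel-⊆M₁ ℓ par meets z z∈ℓ with w , w∈ℓ , w∈M₁ ← toWitness meets =
      fromWitness (parallel-⊆ (toWitness par) (line-nondegenerate ℓ) w∈ℓ w∈M₁ (toWitness z∈ℓ))

  module Rows          = Direction 0 1 1 1<p (inj₂ p∤1) row₀-size row₁-size
  module Columns       = Direction 1 0 1 1<p (inj₁ p∤1) (trans (cong suc (column-size 0 0<p)) row₀-size) (trans (column-size 1 1<p) row₁-size)
  module Antidiagonals = Direction 1 1 (p ∸ 1) p∸1<p (inj₁ p∤1) antidiagonal₀-size antidiagonal₋₁-size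

  generic : Line p → Bool
  generic ℓ = not (Rows.parallel ℓ) ∧ not (Columns.parallel ℓ) ∧ not (Antidiagonals.parallel ℓ)

  generic⇒Generic : ∀ ℓ → T (generic ℓ) → Generic (eqn ℓ)
  generic⇒Generic ℓ gen = record
    { p∤a   = λ p∣a   → T-not⇒¬T R ¬R (fromWitness (subst (ℤ.+ p ∣_) (sym (det-row (eqn ℓ) {0} {0<p})) p∣a))
    ; p∤b   = λ p∣b   → T-not⇒¬T C ¬C (fromWitness (subst (ℤ.+ p ∣_) (sym (det-column (eqn ℓ) {0} {0<p})) (∣m⇒∣-m p∣b)))
    ; p∤a-b = λ p∣a-b → T-not⇒¬T A ¬A (fromWitness (subst (ℤ.+ p ∣_) (sym (det-antidiagonal (eqn ℓ) {0} {0<p})) p∣a-b))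
    }
    where
    R C A : Bool
    R = Rows.parallel ℓ
    C = Columns.parallel ℓ
    A = Antidiagonals.parallel ℓ
    ¬R : T (not R)
    ¬R = T-∧ˡ (not R) gen
    ¬C : T (not C)
    ¬C = T-∧ˡ (not C) (T-∧ʳ (not R) gen)
    ¬A : T (not A)
    ¬A = T-∧ʳ (not C) (T-∧ʳ (not R) gen)

  private
    p∣a : ∀ ℓ → T (Rows.parallel ℓ) → ℤ.+ p ∣ ℤ.+ toℕ (Line.a ℓ)
    p∣a ℓ par = subst (ℤ.+ p ∣_) (det-row (eqn ℓ) {0} {0<p}) (toWitness par)

    p∣b : ∀ ℓ → T (Columns.parallel ℓ) → ℤ.+ p ∣ ℤ.+ toℕ (Line.b ℓ)
    p∣b ℓ par = subst (ℤ.+ p ∣_) (ℤ.neg-involutive _) (∣m⇒∣-m (subst (ℤ.+ p ∣_) (det-column (eqn ℓ) {0} {0<p}) (toWitness par)))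

    p∣a-b : ∀ ℓ → T (Antidiagonals.parallel ℓ) → ℤ.+ p ∣ ℤ.+ toℕ (Line.a ℓ) ℤ.- ℤ.+ toℕ (Line.b ℓ)
    p∣a-b ℓ par = subst (ℤ.+ p ∣_) (det-antidiagonal (eqn ℓ) {0} {0<p}) (toWitness par)

    not-both : ∀ ℓ → ℤ.+ p ∣ ℤ.+ toℕ (Line.a ℓ) → ℤ.+ p ∣ ℤ.+ toℕ (Line.b ℓ) → ⊥
    not-both ℓ p∣a p∣b = [ (λ p∤a → p∤a p∣a) , (λ p∤b → p∤b p∣b) ]′ (line-nondegenerate ℓ)

    one-direction : ∀ ℓ → χ (generic ℓ) + (χ (Rows.parallel ℓ) + (χ (Columns.parallel ℓ) + χ (Antidiagonals.parallel ℓ))) ≤ 1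
    one-direction ℓ with Rows.parallel ℓ in r | Columns.parallel ℓ in c | Antidiagonals.parallel ℓ in a
    ... | false | false | false = ≤-refl
    ... | true  | false | false = ≤-refl
    ... | false | true  | false = ≤-refl
    ... | false | false | true  = ≤-refl
    ... | true  | true  | _     = ⊥-elim (not-both ℓ (p∣a ℓ (≡true⇒T r)) (p∣b ℓ (≡true⇒T c)))
    ... | true  | false | true  = ⊥-elim (not-both ℓ (p∣a ℓ (≡true⇒T r)) (subst (ℤ.+ p ∣_) (cancel (ℤ.+ toℕ (Line.a ℓ)) (ℤ.+ toℕ (Line.b ℓ))) (∣m∣n⇒∣m-n (p∣a ℓ (≡true⇒T r)) (p∣a-b ℓ (≡true⇒T a)))))
      where
      cancel : ∀ i j → i ℤ.- (i ℤ.- j) ≡ j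
      cancel = ℤ-Solver.solve-∀
    ... | false | true  | true  = ⊥-elim (not-both ℓ (subst (ℤ.+ p ∣_) (cancel (ℤ.+ toℕ (Line.a ℓ)) (ℤ.+ toℕ (Line.b ℓ))) (∣m∣n⇒∣m+n (p∣a-b ℓ (≡true⇒T a)) (p∣b ℓ (≡true⇒T c)))) (p∣b ℓ (≡true⇒T c)))
      where
      cancel : ∀ i j → (i ℤ.- j) ℤ.+ j ≡ i
      cancel = ℤ-Solver.solve-∀

  generics : ℕ
  generics = ∑[ ℓ ∈ L ] χ (generic ℓ)

  generics+directions≤p : generics + (∑[ ℓ ∈ L ] χ (Rows.parallel ℓ) + (∑[ ℓ ∈ L ] χ (Columns.parallel ℓ) + ∑[ ℓ ∈ L ] χ (Antidiagonals.parallel ℓ))) ≤ p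
  generics+directions≤p = begin
    generics + (∑[ ℓ ∈ L ] χ (Rows.parallel ℓ) + (∑[ ℓ ∈ L ] χ (Columns.parallel ℓ) + ∑[ ℓ ∈ L ] χ (Antidiagonals.parallel ℓ)))
      ≡⟨ sym (trans (∑ₗ-distrib-+ L _ _) (cong (generics +_) (trans (∑ₗ-distrib-+ L _ _) (cong (∑[ ℓ ∈ L ] χ (Rows.parallel ℓ) +_) (∑ₗ-distrib-+ L _ _))))) ⟩
    ∑[ ℓ ∈ L ] (χ (generic ℓ) + (χ (Rows.parallel ℓ) + (χ (Columns.parallel ℓ) + χ (Antidiagonals.parallel ℓ))))
      ≤⟨ ∑ₗ-mono-≤ (All.universal one-direction L) ⟩
    ∑[ ℓ ∈ L ] 1            ≡⟨ trans (∑ₗ-const L 1) (*-identityʳ _) ⟩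
    length L                ≤⟨ short ⟩
    p                       ∎
    where open ≤-Reasoning

  Inside : (Point p → Bool) → Line p → Set
  Inside Z ℓ = ∀ z → T (⟪ ℓ ⟫ z) → T (Z z)

  classify : (Z : Point p → Bool) →
    (Any (T ∘ Rows.parallel) L → ∀ z → T (⟦ row₁ ⟧ z) → T (Z z)) →
    (Any (T ∘ Columns.parallel) L → ∀ z → T (⟦ column₁ ⟧ z) → T (Z z)) →
    (Any (T ∘ Antidiagonals.parallel) L → ∀ z → T (⟦ antidiagonal₋₁ ⟧ z) → T (Z z)) →
    All (λ ℓ → T (generic ℓ) ⊎ (¬ T (generic ℓ) × Inside Z ℓ)) L
  classify Z rows⊆Z columns⊆Z antidiagonals⊆Z = All.tabulate λ {ℓ} → kind ℓ
    where
    present : ∀ {ℓ} (P : Line p → Bool) → Any (ℓ ≡_) L → P ℓ ≡ true → Any (T ∘ P) L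
    present P ℓ∈L Pℓ = Any.map (λ { refl → ≡true⇒T Pℓ }) ℓ∈L
    kind : ∀ ℓ → Any (ℓ ≡_) L → T (generic ℓ) ⊎ (¬ T (generic ℓ) × Inside Z ℓ)
    kind ℓ ℓ∈L with Rows.parallel ℓ in r | Columns.parallel ℓ in c | Antidiagonals.parallel ℓ in a
    ... | true  | _     | _     = inj₂ ((λ ()) , λ z z∈ℓ → rows⊆Z (present Rows.parallel ℓ∈L r) z
      (Rows.parallel-⊆M₁ ℓ (≡true⇒T r) (All.lookup Rows.parallel⇒meets-M₁ ℓ∈L (≡true⇒T r)) z z∈ℓ))
    ... | false | true  | _     = inj₂ ((λ ()) , λ z z∈ℓ → columns⊆Z (present Columns.parallel ℓ∈L c) z
      (Columns.parallel-⊆M₁ ℓ (≡true⇒T c) (All.lookup Columns.parallel⇒meets-M₁ ℓ∈L (≡true⇒T c)) z z∈ℓ))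
    ... | false | false | true  = inj₂ ((λ ()) , λ z z∈ℓ → antidiagonals⊆Z (present Antidiagonals.parallel ℓ∈L a) z
      (Antidiagonals.parallel-⊆M₁ ℓ (≡true⇒T a) (All.lookup Antidiagonals.parallel⇒meets-M₁ ℓ∈L (≡true⇒T a)) z z∈ℓ))
    ... | false | false | false = inj₁ _

  generic-bound : (Z : Point p → Bool) (d : ℕ) →
    All (λ ℓ → T (generic ℓ) ⊎ (¬ T (generic ℓ) × Inside Z ℓ)) L →
    (∀ ℓ → T (generic ℓ) → toℕ (Line.c ℓ) ≢ 0 → d ≤ # ((⟪ ℓ ⟫ ∩ S∖0) ∩ Z)) →
    2 * # (S∖0 ∖ Z) + 2 * d * generics ≤ (p + 3) * generics
  generic-bound Z d kinds hits = begin
    2 * # (S∖0 ∖ Z) + 2 * d * generics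
      ≤⟨ +-monoˡ-≤ _ (*-monoʳ-≤ 2 (covering-bound (S∖0 ∖ Z) (λ z → T-∧ˡ (S∖0 z)))) ⟩
    2 * ∑[ ℓ ∈ L ] # (⟪ ℓ ⟫ ∩ (S∖0 ∖ Z)) + 2 * d * generics
      ≡⟨ sym (cong₂ _+_ (∑ₗ-*ˡ L 2 _) (∑ₗ-*ˡ L (2 * d) _)) ⟩
    ∑[ ℓ ∈ L ] (2 * # (⟪ ℓ ⟫ ∩ (S∖0 ∖ Z))) + ∑[ ℓ ∈ L ] (2 * d * χ (generic ℓ))
      ≡⟨ sym (∑ₗ-distrib-+ L _ _) ⟩
    ∑[ ℓ ∈ L ] (2 * # (⟪ ℓ ⟫ ∩ (S∖0 ∖ Z)) + 2 * d * χ (generic ℓ))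
      ≤⟨ ∑ₗ-mono-≤ (All.zipWith (λ {ℓ} (kind , c≢0) → per-line ℓ kind c≢0) (kinds , avoids)) ⟩
    ∑[ ℓ ∈ L ] ((p + 3) * χ (generic ℓ))
      ≡⟨ ∑ₗ-*ˡ L (p + 3) _ ⟩
    (p + 3) * generics ∎
    where
    open ≤-Reasoning
    per-line : ∀ ℓ → T (generic ℓ) ⊎ (¬ T (generic ℓ) × Inside Z ℓ) → toℕ (Line.c ℓ) ≢ 0 →
      2 * # (⟪ ℓ ⟫ ∩ (S∖0 ∖ Z)) + 2 * d * χ (generic ℓ) ≤ (p + 3) * χ (generic ℓ)
    per-line ℓ (inj₁ gen) c≢0 = begin
      2 * # (⟪ ℓ ⟫ ∩ (S∖0 ∖ Z)) + 2 * d * χ (generic ℓ)   ≡⟨ cong (λ k → 2 * # (⟪ ℓ ⟫ ∩ (S∖0 ∖ Z)) + 2 * d * k) (χ-T gen) ⟩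
      2 * # (⟪ ℓ ⟫ ∩ (S∖0 ∖ Z)) + 2 * d * 1               ≡⟨ factor (# (⟪ ℓ ⟫ ∩ (S∖0 ∖ Z))) d ⟩
      2 * (# (⟪ ℓ ⟫ ∩ (S∖0 ∖ Z)) + d)                     ≤⟨ *-monoʳ-≤ 2 (+-monoʳ-≤ (# (⟪ ℓ ⟫ ∩ (S∖0 ∖ Z))) (hits ℓ gen c≢0)) ⟩
      2 * (# (⟪ ℓ ⟫ ∩ (S∖0 ∖ Z)) + # ((⟪ ℓ ⟫ ∩ S∖0) ∩ Z)) ≡⟨ cong (2 *_) split ⟩
      2 * # (⟪ ℓ ⟫ ∩ S∖0)                                 ≤⟨ generic-size (generic⇒Generic ℓ gen) ⟩
      p + 3                                               ≡⟨ sym (trans (cong ((p + 3) *_) (χ-T gen)) (*-identityʳ (p + 3))) ⟩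
      (p + 3) * χ (generic ℓ)                             ∎
      where
      factor : ∀ x d → 2 * x + 2 * d * 1 ≡ 2 * (x + d)
      factor = solve-∀
      split : # (⟪ ℓ ⟫ ∩ (S∖0 ∖ Z)) + # ((⟪ ℓ ⟫ ∩ S∖0) ∩ Z) ≡ # (⟪ ℓ ⟫ ∩ S∖0)
      split = sym (trans (#-split (⟪ ℓ ⟫ ∩ S∖0) Z) (trans (+-comm (# (Z ∩ (⟪ ℓ ⟫ ∩ S∖0))) (# ((⟪ ℓ ⟫ ∩ S∖0) ∖ Z)))
        (cong₂ _+_ (∑²-cong λ z → cong χ (∧-assoc (⟪ ℓ ⟫ z) (S∖0 z) (not (Z z)))) (#-∩-comm Z (⟪ ℓ ⟫ ∩ S∖0)))))
    per-line ℓ (inj₂ (¬gen , inside)) _ = begin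
      2 * # (⟪ ℓ ⟫ ∩ (S∖0 ∖ Z)) + 2 * d * χ (generic ℓ)   ≡⟨ cong₂ (λ u v → 2 * u + 2 * d * v) outside-Z-empty (χ-F ¬gen) ⟩
      2 * d * 0                                            ≡⟨ *-zeroʳ (2 * d) ⟩
      0                                                    ≤⟨ z≤n ⟩
      (p + 3) * χ (generic ℓ)                              ∎
      where
      outside-Z-empty : # (⟪ ℓ ⟫ ∩ (S∖0 ∖ Z)) ≡ 0
      outside-Z-empty = #-empty _ λ z h → T-not⇒¬T (Z z) (T-∧ʳ (S∖0 z) (T-∧ʳ (⟪ ℓ ⟫ z) h)) (inside z (T-∧ˡ (⟪ ℓ ⟫ z) h))

  private
    slack : ∀ s D E g G → D ≤ E → g ≤ G → s + D * g ≤ E * g → s + D * G ≤ E * G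
    slack s D E g G D≤E g≤G bound with t , refl ← m≤n⇒∃[o]m+o≡n g≤G = begin
      s + D * (g + t)        ≡⟨ regroup s D g t ⟩
      s + D * g + D * t      ≤⟨ +-mono-≤ bound (*-monoˡ-≤ t D≤E) ⟩
      E * g + E * t          ≡⟨ sym (*-distribˡ-+ E g t) ⟩
      E * (g + t)            ∎
      where
      open ≤-Reasoning
      regroup : ∀ s D g t → s + D * (g + t) ≡ s + D * g + D * t
      regroup = solve-∀

  case-bound : (Z : Point p → Bool) (d G : ℕ) →
    All (λ ℓ → T (generic ℓ) ⊎ (¬ T (generic ℓ) × Inside Z ℓ)) L →
    (∀ ℓ → T (generic ℓ) → toℕ (Line.c ℓ) ≢ 0 → d ≤ # ((⟪ ℓ ⟫ ∩ S∖0) ∩ Z)) →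
    generics ≤ G → 2 * d ≤ p + 3 →
    p * p + 3 * p + 2 * d * G ≤ 2 * # (S∖0 ∩ Z) + 4 + (p + 3) * G
  case-bound Z d G kinds hits few 2d≤p+3 = begin
    p * p + 3 * p + 2 * d * G                                  ≡⟨ cong (_+ 2 * d * G) (sym S∖0-size) ⟩
    2 * # S∖0 + 4 + 2 * d * G                                  ≡⟨ cong (λ n → 2 * n + 4 + 2 * d * G) (trans (#-split S∖0 Z) (cong (_+ # (S∖0 ∖ Z)) (#-∩-comm Z S∖0))) ⟩
    2 * (# (S∖0 ∩ Z) + # (S∖0 ∖ Z)) + 4 + 2 * d * G            ≡⟨ regroup (# (S∖0 ∩ Z)) (# (S∖0 ∖ Z)) (2 * d * G) ⟩
    2 * # (S∖0 ∩ Z) + 4 + (2 * # (S∖0 ∖ Z) + 2 * d * G)        ≤⟨ +-monoʳ-≤ (2 * # (S∖0 ∩ Z) + 4)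
                                                                   (slack _ (2 * d) (p + 3) generics G 2d≤p+3 few (generic-bound Z d kinds hits)) ⟩
    2 * # (S∖0 ∩ Z) + 4 + (p + 3) * G                          ∎
    where
    open ≤-Reasoning
    regroup : ∀ z s k → 2 * (z + s) + 4 + k ≡ 2 * z + 4 + (2 * s + k)
    regroup = solve-∀

  single-case : ∀ {M} → TestLine M → # (S∖0 ∩ ⟦ M ⟧) ≡ p →
    All (λ ℓ → T (generic ℓ) ⊎ (¬ T (generic ℓ) × Inside ⟦ M ⟧ ℓ)) L → generics + 1 ≤ p →
    p * p + 3 * p + 2 * 1 * (p ∸ 1) ≤ 2 * p + 4 + (p + 3) * (p ∸ 1)
  single-case {M} t size kinds few = subst (λ n → p * p + 3 * p + 2 * 1 * (p ∸ 1) ≤ 2 * n + 4 + (p + 3) * (p ∸ 1)) size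
    (case-bound ⟦ M ⟧ 1 (p ∸ 1) kinds
      (λ ℓ gen c≢0 → ≤-reflexive (sym (generic-meets-once t (generic⇒Generic ℓ gen) c≢0)))
      (m+n≤o⇒m≤o∸n generics few) (≤-trans (≤-trans (s≤s (s≤s z≤n)) 5≤p) (m≤m+n p 3)))

  triangle-case : ∀ {M₁ M₂ M₃} → TestLine M₁ → TestLine M₂ → TestLine M₃ →
    NoTriplePoint S∖0 ⟦ M₁ ⟧ ⟦ M₂ ⟧ ⟦ M₃ ⟧ →
    1 ≤ # (S∖0 ∩ ⟦ M₁ ⟧ ∩ ⟦ M₂ ⟧) → 1 ≤ # (S∖0 ∩ ⟦ M₁ ⟧ ∩ ⟦ M₃ ⟧) → 1 ≤ # (S∖0 ∩ ⟦ M₂ ⟧ ∩ ⟦ M₃ ⟧) →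
    All (λ ℓ → T (generic ℓ) ⊎ (¬ T (generic ℓ) × Inside (⟦ M₁ ⟧ ∪ ⟦ M₂ ⟧ ∪ ⟦ M₃ ⟧) ℓ)) L → ∀ G → generics ≤ G →
    p * p + 3 * p + 2 * 2 * G + 6 ≤ 2 * (# (S∖0 ∩ ⟦ M₁ ⟧) + # (S∖0 ∩ ⟦ M₂ ⟧) + # (S∖0 ∩ ⟦ M₃ ⟧)) + 4 + (p + 3) * G
  triangle-case {M₁} {M₂} {M₃} t₁ t₂ t₃ no-triple m₁₂ m₁₃ m₂₃ kinds G few = begin
    p * p + 3 * p + 2 * 2 * G + 6                      ≤⟨ +-monoˡ-≤ 6 (case-bound Z 2 G kinds
                                                            (λ ℓ gen c≢0 → generic-meets-triangle t₁ t₂ t₃ no-triple (generic⇒Generic ℓ gen) c≢0)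
                                                            few (≤-trans (≤-trans (s≤s (s≤s (s≤s (s≤s z≤n)))) 5≤p) (m≤m+n p 3))) ⟩
    2 * # (S∖0 ∩ Z) + 4 + (p + 3) * G + 6               ≡⟨ regroup (# (S∖0 ∩ Z)) ((p + 3) * G) ⟩
    2 * (# (S∖0 ∩ Z) + 3) + 4 + (p + 3) * G             ≤⟨ +-monoˡ-≤ _ (+-monoˡ-≤ 4 (*-monoʳ-≤ 2 (#-∪₃-overlapping S∖0 ⟦ M₁ ⟧ ⟦ M₂ ⟧ ⟦ M₃ ⟧ no-triple m₁₂ m₁₃ m₂₃))) ⟩
    2 * (# (S∖0 ∩ ⟦ M₁ ⟧) + # (S∖0 ∩ ⟦ M₂ ⟧) + # (S∖0 ∩ ⟦ M₃ ⟧)) + 4 + (p + 3) * G ∎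
    where
    open ≤-Reasoning
    Z = ⟦ M₁ ⟧ ∪ ⟦ M₂ ⟧ ∪ ⟦ M₃ ⟧
    regroup : ∀ z k → 2 * z + 4 + k + 6 ≡ 2 * (z + 3) + 4 + k
    regroup = solve-∀

  private
    q : ℕ
    q = p ∸ 5

    p≡5+q : p ≡ 5 + q
    p≡5+q = trans (sym (m∸n+n≡m 5≤p)) (+-comm q 5)

    refute : ∀ {a b} k → b + suc k ≡ a → ¬ (a ≤ b)
    refute {a} {b} k b+1+k≡a a≤b = <-irrefl refl (<-≤-trans (m<m+n b z<s) (≤-trans (≤-reflexive b+1+k≡a) a≤b))

    star-refute : ∀ z → z + 3 ≡ 3 * p → ¬ (p * p + 3 * p + 2 * 3 * p ≤ 2 * z + 4 + (p + 3) * p)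
    star-refute z z+3≡3p = refute 1 (begin-equality
      2 * z + 4 + (p + 3) * p + 2          ≡⟨ regroup z p ⟩
      2 * (z + 3) + (p + 3) * p            ≡⟨ cong (λ k → 2 * k + (p + 3) * p) z+3≡3p ⟩
      2 * (3 * p) + (p + 3) * p            ≡⟨ expand p ⟩
      p * p + 3 * p + 2 * 3 * p            ∎)
      where
      open ≤-Reasoning
      regroup : ∀ z p → 2 * z + 4 + (p + 3) * p + 2 ≡ 2 * (z + 3) + (p + 3) * p
      regroup = solve-∀
      expand : ∀ p → 2 * (3 * p) + (p + 3) * p ≡ p * p + 3 * p + 2 * 3 * p
      expand = solve-∀

    single-refute : ¬ (p * p + 3 * p + 2 * 1 * (p ∸ 1) ≤ 2 * p + 4 + (p + 3) * (p ∸ 1))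
    single-refute = subst (λ n → ¬ (n * n + 3 * n + 2 * 1 * (n ∸ 1) ≤ 2 * n + 4 + (n + 3) * (n ∸ 1))) (sym p≡5+q)
      (refute (1 + q) (expand q))
      where
      expand : ∀ q → 2 * (5 + q) + 4 + (5 + q + 3) * (4 + q) + suc (1 + q) ≡ (5 + q) * (5 + q) + 3 * (5 + q) + 2 * 1 * (4 + q)
      expand = solve-∀

    triangle₂-refute : ∀ σ → σ + 1 ≡ 3 * p → ¬ (p * p + 3 * p + 2 * 2 * (p ∸ 2) + 6 ≤ 2 * σ + 4 + (p + 3) * (p ∸ 2))
    triangle₂-refute σ σ+1≡3p = refute 1 (begin-equality
      2 * σ + 4 + (p + 3) * (p ∸ 2) + 2   ≡⟨ regroup σ ((p + 3) * (p ∸ 2)) ⟩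
      2 * (σ + 1) + 4 + (p + 3) * (p ∸ 2) ≡⟨ cong (λ k → 2 * k + 4 + (p + 3) * (p ∸ 2)) σ+1≡3p ⟩
      2 * (3 * p) + 4 + (p + 3) * (p ∸ 2) ≡⟨ subst (λ n → 2 * (3 * n) + 4 + (n + 3) * (n ∸ 2) ≡ n * n + 3 * n + 2 * 2 * (n ∸ 2) + 6) (sym p≡5+q) (expand q) ⟩
      p * p + 3 * p + 2 * 2 * (p ∸ 2) + 6 ∎)
      where
      open ≤-Reasoning
      regroup : ∀ σ k → 2 * σ + 4 + k + 2 ≡ 2 * (σ + 1) + 4 + k
      regroup = solve-∀
      expand : ∀ q → 2 * (3 * (5 + q)) + 4 + (5 + q + 3) * (3 + q) ≡ (5 + q) * (5 + q) + 3 * (5 + q) + 2 * 2 * (3 + q) + 6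
      expand = solve-∀
    triangle₃-refute : ∀ σ → σ ≡ 3 * p → ¬ (p * p + 3 * p + 2 * 2 * (p ∸ 3) + 6 ≤ 2 * σ + 4 + (p + 3) * (p ∸ 3))
    triangle₃-refute σ σ≡3p = refute (3 + q) (begin-equality
      2 * σ + 4 + (p + 3) * (p ∸ 3) + suc (3 + q)   ≡⟨ cong (λ k → 2 * k + 4 + (p + 3) * (p ∸ 3) + suc (3 + q)) σ≡3p ⟩
      2 * (3 * p) + 4 + (p + 3) * (p ∸ 3) + suc (3 + q) ≡⟨ subst (λ n → 2 * (3 * n) + 4 + (n + 3) * (n ∸ 3) + suc (3 + q) ≡ n * n + 3 * n + 2 * 2 * (n ∸ 3) + 6) (sym p≡5+q) (expand q) ⟩
      p * p + 3 * p + 2 * 2 * (p ∸ 3) + 6     ∎)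
      where
      open ≤-Reasoning
      expand : ∀ q → 2 * (3 * (5 + q)) + 4 + (5 + q + 3) * (2 + q) + suc (3 + q) ≡ (5 + q) * (5 + q) + 3 * (5 + q) + 2 * 2 * (2 + q) + 6
      expand = solve-∀

    2<p : 2 < p
    2<p = ≤-trans (s≤s (s≤s (s≤s z≤n))) 5≤p

    p∸2<p : p ∸ 2 < p
    p∸2<p = ∸-monoʳ-< (s≤s z≤n) (<⇒≤ 2<p)

    p∸1+1≡p : p ∸ 1 + 1 ≡ p
    p∸1+1≡p = m∸n+n≡m (<⇒≤ 1<p)

    1+p∸1≡p : 1 + (p ∸ 1) ≡ p
    1+p∸1≡p = m+[n∸m]≡n (<⇒≤ 1<p)

    1+p∸2≡p∸1 : 1 + (p ∸ 2) ≡ p ∸ 1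
    1+p∸2≡p∸1 = sym (+-∸-assoc 1 (<⇒≤ 2<p))

    p%p≡0 : ∀ {m} → m ≡ p → m % p ≡ 0
    p%p≡0 refl = n%n≡0 p

    small : ∀ {m} → m < p → m % p ≡ m
    small = m<n⇒m%n≡m

    p∸1≢1 : p ∸ 1 ≢ 1
    p∸1≢1 p∸1≡1 = <-irrefl refl (≤-trans 2<p (≤-reflexive (trans (sym p∸1+1≡p) (cong (_+ 1) p∸1≡1))))

    p∸1≢2 : p ∸ 1 ≢ 2
    p∸1≢2 p∸1≡2 = contradiction (≤-trans 5≤p (≤-reflexive (trans (sym p∸1+1≡p) (cong (_+ 1) p∸1≡2)))) λ { (s≤s (s≤s (s≤s ()))) }

  private
    R C A : Line p → Bool
    R = Rows.parallel
    C = Columns.parallel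
    A = Antidiagonals.parallel

    rs cs as : ℕ
    rs = ∑[ ℓ ∈ L ] χ (R ℓ)
    cs = ∑[ ℓ ∈ L ] χ (C ℓ)
    as = ∑[ ℓ ∈ L ] χ (A ℓ)

    few-generics : ∀ s → s ≤ rs + (cs + as) → generics ≤ p ∸ s
    few-generics s s≤ = m+n≤o⇒m≤o∸n generics (≤-trans (+-monoʳ-≤ generics s≤) generics+directions≤p)

    count-present : ∀ {P : Line p → Bool} → Any (T ∘ P) L → 1 ≤ ∑[ ℓ ∈ L ] χ (P ℓ)
    count-present {P} = ∑ₗ-χ-any P

    absent : ∀ {P : Line p → Bool} {Z : Point p → Bool} {M : Equation} → ¬ Any (T ∘ P) L → Any (T ∘ P) L → ∀ z → T (⟦ M ⟧ z) → T (Z z)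
    absent ¬any any = contradiction any ¬any

    first : ∀ {X Y W : Point p → Bool} {M : Equation} → (∀ z → T (⟦ M ⟧ z) → T (X z)) → ∀ {Q : Set} → Q → ∀ z → T (⟦ M ⟧ z) → T ((X ∪ Y ∪ W) z)
    first M⊆X _ z h = T-∨-introˡ _ (M⊆X z h)

  all-generic-case : ¬ Any (T ∘ R) L → ¬ Any (T ∘ C) L → ¬ Any (T ∘ A) L → ⊥
  all-generic-case ¬R ¬C ¬A = star-refute _ star-size
    (case-bound Z 3 p (classify Z (absent ¬R) (absent ¬C) (absent ¬A))
      (λ ℓ gen c≢0 → ≤-reflexive (sym (generic-meets-star (generic⇒Generic ℓ gen) c≢0)))
      (≤-trans (m≤m+n generics _) generics+directions≤p) (+-monoˡ-≤ 3 (≤-trans (s≤s (s≤s (s≤s z≤n))) 5≤p)))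
    where
    Z = ⟦ row₀ ⟧ ∪ ⟦ column₀ ⟧ ∪ ⟦ antidiagonal₀ ⟧

  rows-case : Any (T ∘ R) L → ¬ Any (T ∘ C) L → ¬ Any (T ∘ A) L → ⊥
  rows-case r ¬C ¬A = single-refute (single-case test-row₁ row₁-size
    (classify ⟦ row₁ ⟧ (λ _ _ h → h) (absent ¬C) (absent ¬A))
    (≤-trans (+-monoʳ-≤ generics (≤-trans (count-present {R} r) (m≤m+n rs (cs + as)))) generics+directions≤p))

  columns-case : ¬ Any (T ∘ R) L → Any (T ∘ C) L → ¬ Any (T ∘ A) L → ⊥
  columns-case ¬R c ¬A = single-refute (single-case test-column₁ (trans (column-size 1 1<p) row₁-size)
    (classify ⟦ column₁ ⟧ (absent ¬R) (λ _ _ h → h) (absent ¬A))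
    (≤-trans (+-monoʳ-≤ generics (≤-trans (count-present {C} c) (≤-trans (m≤m+n cs as) (m≤n+m (cs + as) rs)))) generics+directions≤p))

  antidiagonals-case : ¬ Any (T ∘ R) L → ¬ Any (T ∘ C) L → Any (T ∘ A) L → ⊥
  antidiagonals-case ¬R ¬C a = single-refute (single-case test-antidiagonal₋₁ antidiagonal₋₁-size
    (classify ⟦ antidiagonal₋₁ ⟧ (absent ¬R) (absent ¬C) (λ _ _ h → h))
    (≤-trans (+-monoʳ-≤ generics (≤-trans (count-present {A} a) (≤-trans (m≤n+m as cs) (m≤n+m (cs + as) rs)))) generics+directions≤p))

  private
    i₀ i₁ i₋₁ i₋₂ : Fin p
    i₀  = fromℕ< 0<p
    i₁  = fromℕ< 1<p
    i₋₁ = fromℕ< p∸1<p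
    i₋₂ = fromℕ< p∸2<p

    S∖0-at : ∀ {x y : Fin p} {m n} → toℕ x ≡ m → toℕ y ≡ n → m + n ≤ p → ¬ (m ≡ 0 × n ≡ 0) → T (S∖0 (x , y))
    S∖0-at refl refl m+n≤p nonzero = S∖0-intro m+n≤p nonzero

    on-antidiagonal : ∀ {x y : Fin p} {m n c c<p} → toℕ x ≡ m → toℕ y ≡ n → (m + n) % p ≡ c → (x , y) ∈ₑ antidiagonal c c<p
    on-antidiagonal refl refl m+n≡c = from ∈-antidiagonal m+n≡c

    on-row : ∀ {x y : Fin p} {c c<p} → toℕ y ≡ c → (x , y) ∈ₑ row c c<p
    on-row = from ∈-row

    on-column : ∀ {x y : Fin p} {c c<p} → toℕ x ≡ c → (x , y) ∈ₑ column c c<p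
    on-column = from ∈-column

    ‖i₀‖ : toℕ i₀ ≡ 0
    ‖i₀‖ = Fin.toℕ-fromℕ< 0<p
    ‖i₁‖ : toℕ i₁ ≡ 1
    ‖i₁‖ = Fin.toℕ-fromℕ< 1<p
    ‖i₋₁‖ : toℕ i₋₁ ≡ p ∸ 1
    ‖i₋₁‖ = Fin.toℕ-fromℕ< p∸1<p
    ‖i₋₂‖ : toℕ i₋₂ ≡ p ∸ 2
    ‖i₋₂‖ = Fin.toℕ-fromℕ< p∸2<p

  rows-columns-case : Any (T ∘ R) L → Any (T ∘ C) L → ¬ Any (T ∘ A) L → ⊥
  rows-columns-case r c ¬A = triangle₂-refute _ sizes (triangle-case test-row₁ test-column₁ test-antidiagonal₀
    (no-triple-point {1} {1} {0} {1<p} {1<p} {0<p} (λ 2≡0 → contradiction (trans (sym (small 2<p)) 2≡0) λ ()))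
    (meeting-point (i₁ , i₁) (S∖0-at ‖i₁‖ ‖i₁‖ (<⇒≤ 2<p) λ { (() , _) }) (on-row ‖i₁‖) (on-column ‖i₁‖))
    (meeting-point (i₋₁ , i₁) (S∖0-at ‖i₋₁‖ ‖i₁‖ (≤-reflexive p∸1+1≡p) λ { (_ , ()) }) (on-row ‖i₁‖) (on-antidiagonal ‖i₋₁‖ ‖i₁‖ (p%p≡0 p∸1+1≡p)))
    (meeting-point (i₁ , i₋₁) (S∖0-at ‖i₁‖ ‖i₋₁‖ (≤-reflexive 1+p∸1≡p) λ { (() , _) }) (on-column ‖i₁‖) (on-antidiagonal ‖i₁‖ ‖i₋₁‖ (p%p≡0 1+p∸1≡p)))
    (classify Z (λ _ z h → T-∨-introˡ (⟦ row₁ ⟧ z) h) (λ _ z h → T-∨-introʳ (⟦ row₁ ⟧ z) (T-∨-introˡ (⟦ column₁ ⟧ z) h)) (absent ¬A))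
    (p ∸ 2) (few-generics 2 (+-mono-≤ (count-present {R} r) (≤-trans (count-present {C} c) (m≤m+n cs as)))))
    where
    Z = ⟦ row₁ ⟧ ∪ ⟦ column₁ ⟧ ∪ ⟦ antidiagonal₀ ⟧
    sizes : # (S∖0 ∩ ⟦ row₁ ⟧) + # (S∖0 ∩ ⟦ column₁ ⟧) + # (S∖0 ∩ ⟦ antidiagonal₀ ⟧) + 1 ≡ 3 * p
    sizes = trans (+-assoc (# (S∖0 ∩ ⟦ row₁ ⟧) + # (S∖0 ∩ ⟦ column₁ ⟧)) (# (S∖0 ∩ ⟦ antidiagonal₀ ⟧)) 1)
      (trans (cong₂ _+_ (cong₂ _+_ row₁-size (trans (column-size 1 1<p) row₁-size)) (trans (+-comm (# (S∖0 ∩ ⟦ antidiagonal₀ ⟧)) 1) antidiagonal₀-size)) (triple p))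
      where
      triple : ∀ p → p + p + p ≡ 3 * p
      triple = solve-∀

  private
    p∸2+1≡p∸1 : p ∸ 2 + 1 ≡ p ∸ 1
    p∸2+1≡p∸1 = trans (+-comm (p ∸ 2) 1) 1+p∸2≡p∸1

    column₁-size : # (S∖0 ∩ ⟦ column₁ ⟧) ≡ p
    column₁-size = trans (column-size 1 1<p) row₁-size

    column₀-size : suc (# (S∖0 ∩ ⟦ column₀ ⟧)) ≡ p
    column₀-size = trans (cong suc (column-size 0 0<p)) row₀-size

    three-sizes : ∀ {a b c a′ b′ c′} → a + a′ ≡ p → b + b′ ≡ p → c + c′ ≡ p → a + b + c + (a′ + b′ + c′) ≡ 3 * p
    three-sizes {a} {b} {c} {a′} {b′} {c′} a+a′≡p b+b′≡p c+c′≡p = begin-equality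
      a + b + c + (a′ + b′ + c′)           ≡⟨ regroup a b c a′ b′ c′ ⟩
      (a + a′) + (b + b′) + (c + c′)       ≡⟨ cong₂ _+_ (cong₂ _+_ a+a′≡p b+b′≡p) c+c′≡p ⟩
      p + p + p                            ≡⟨ triple p ⟩
      3 * p                                ∎
      where
      open ≤-Reasoning
      regroup : ∀ a b c a′ b′ c′ → a + b + c + (a′ + b′ + c′) ≡ (a + a′) + (b + b′) + (c + c′)
      regroup = solve-∀
      triple : ∀ p → p + p + p ≡ 3 * p
      triple = solve-∀

    full-size : ∀ {a} → a ≡ p → a + 0 ≡ p
    full-size = trans (+-identityʳ _)

    off-origin-size : ∀ {a} → suc a ≡ p → a + 1 ≡ p
    off-origin-size {a} = trans (+-comm a 1)

  rows-antidiagonals-case : Any (T ∘ R) L → ¬ Any (T ∘ C) L → Any (T ∘ A) L → ⊥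
  rows-antidiagonals-case r ¬C a = triangle₂-refute _ sizes (triangle-case test-row₁ test-column₀ test-antidiagonal₋₁
    (no-triple-point {0} {1} {p ∸ 1} {0<p} {1<p} {p∸1<p} (λ 1≡p∸1 → p∸1≢1 (trans (sym 1≡p∸1) (small 1<p))))
    (meeting-point (i₀ , i₁) (S∖0-at ‖i₀‖ ‖i₁‖ (<⇒≤ 1<p) λ { (_ , ()) }) (on-row ‖i₁‖) (on-column ‖i₀‖))
    (meeting-point (i₋₂ , i₁) (S∖0-at ‖i₋₂‖ ‖i₁‖ (≤-trans (≤-reflexive p∸2+1≡p∸1) (m∸n≤m p 1)) λ { (_ , ()) })
      (on-row ‖i₁‖) (on-antidiagonal ‖i₋₂‖ ‖i₁‖ (trans (cong (_% p) p∸2+1≡p∸1) (small p∸1<p))))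
    (meeting-point (i₀ , i₋₁) (S∖0-at ‖i₀‖ ‖i₋₁‖ (m∸n≤m p 1) λ (_ , p∸1≡0) → p∸1≢0 p∸1≡0)
      (on-column ‖i₀‖) (on-antidiagonal ‖i₀‖ ‖i₋₁‖ (small p∸1<p)))
    (classify Z (λ _ z h → T-∨-introˡ (⟦ row₁ ⟧ z) h) (absent ¬C) (λ _ z h → T-∨-introʳ (⟦ row₁ ⟧ z) (T-∨-introʳ (⟦ column₀ ⟧ z) h)))
    (p ∸ 2) (few-generics 2 (+-mono-≤ (count-present {R} r) (≤-trans (count-present {A} a) (m≤n+m as cs)))))
    where
    Z = ⟦ row₁ ⟧ ∪ ⟦ column₀ ⟧ ∪ ⟦ antidiagonal₋₁ ⟧
    sizes : # (S∖0 ∩ ⟦ row₁ ⟧) + # (S∖0 ∩ ⟦ column₀ ⟧) + # (S∖0 ∩ ⟦ antidiagonal₋₁ ⟧) + 1 ≡ 3 * p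
    sizes = three-sizes {# (S∖0 ∩ ⟦ row₁ ⟧)} {# (S∖0 ∩ ⟦ column₀ ⟧)} {# (S∖0 ∩ ⟦ antidiagonal₋₁ ⟧)} {0} {1} {0}
      (full-size row₁-size) (off-origin-size column₀-size) (full-size antidiagonal₋₁-size)

  columns-antidiagonals-case : ¬ Any (T ∘ R) L → Any (T ∘ C) L → Any (T ∘ A) L → ⊥
  columns-antidiagonals-case ¬R c a = triangle₂-refute _ sizes (triangle-case test-row₀ test-column₁ test-antidiagonal₋₁
    (no-triple-point {1} {0} {p ∸ 1} {1<p} {0<p} {p∸1<p} (λ 1≡p∸1 → p∸1≢1 (trans (sym 1≡p∸1) (small 1<p))))
    (meeting-point (i₁ , i₀) (S∖0-at ‖i₁‖ ‖i₀‖ (<⇒≤ 1<p) λ { (() , _) }) (on-row ‖i₀‖) (on-column ‖i₁‖))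
    (meeting-point (i₋₁ , i₀) (S∖0-at ‖i₋₁‖ ‖i₀‖ (≤-trans (≤-reflexive (+-identityʳ (p ∸ 1))) (m∸n≤m p 1)) λ (p∸1≡0 , _) → p∸1≢0 p∸1≡0)
      (on-row ‖i₀‖) (on-antidiagonal ‖i₋₁‖ ‖i₀‖ (trans (cong (_% p) (+-identityʳ (p ∸ 1))) (small p∸1<p))))
    (meeting-point (i₁ , i₋₂) (S∖0-at ‖i₁‖ ‖i₋₂‖ (≤-trans (≤-reflexive 1+p∸2≡p∸1) (m∸n≤m p 1)) λ { (() , _) })
      (on-column ‖i₁‖) (on-antidiagonal ‖i₁‖ ‖i₋₂‖ (trans (cong (_% p) 1+p∸2≡p∸1) (small p∸1<p))))
    (classify Z (absent ¬R) (λ _ z h → T-∨-introʳ (⟦ row₀ ⟧ z) (T-∨-introˡ (⟦ column₁ ⟧ z) h)) (λ _ z h → T-∨-introʳ (⟦ row₀ ⟧ z) (T-∨-introʳ (⟦ column₁ ⟧ z) h)))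
    (p ∸ 2) (few-generics 2 (≤-trans (+-mono-≤ (count-present {C} c) (count-present {A} a)) (m≤n+m (cs + as) rs))))
    where
    Z = ⟦ row₀ ⟧ ∪ ⟦ column₁ ⟧ ∪ ⟦ antidiagonal₋₁ ⟧
    sizes : # (S∖0 ∩ ⟦ row₀ ⟧) + # (S∖0 ∩ ⟦ column₁ ⟧) + # (S∖0 ∩ ⟦ antidiagonal₋₁ ⟧) + 1 ≡ 3 * p
    sizes = three-sizes {# (S∖0 ∩ ⟦ row₀ ⟧)} {# (S∖0 ∩ ⟦ column₁ ⟧)} {# (S∖0 ∩ ⟦ antidiagonal₋₁ ⟧)} {1} {0} {0}
      (off-origin-size row₀-size) (full-size column₁-size) (full-size antidiagonal₋₁-size)

  all-directions-case : Any (T ∘ R) L → Any (T ∘ C) L → Any (T ∘ A) L → ⊥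
  all-directions-case r c a = triangle₃-refute _ sizes (triangle-case test-row₁ test-column₁ test-antidiagonal₋₁
    (no-triple-point {1} {1} {p ∸ 1} {1<p} {1<p} {p∸1<p} (λ 2≡p∸1 → p∸1≢2 (trans (sym 2≡p∸1) (small 2<p))))
    (meeting-point (i₁ , i₁) (S∖0-at ‖i₁‖ ‖i₁‖ (<⇒≤ 2<p) λ { (() , _) }) (on-row ‖i₁‖) (on-column ‖i₁‖))
    (meeting-point (i₋₂ , i₁) (S∖0-at ‖i₋₂‖ ‖i₁‖ (≤-trans (≤-reflexive p∸2+1≡p∸1) (m∸n≤m p 1)) λ { (_ , ()) })
      (on-row ‖i₁‖) (on-antidiagonal ‖i₋₂‖ ‖i₁‖ (trans (cong (_% p) p∸2+1≡p∸1) (small p∸1<p))))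
    (meeting-point (i₁ , i₋₂) (S∖0-at ‖i₁‖ ‖i₋₂‖ (≤-trans (≤-reflexive 1+p∸2≡p∸1) (m∸n≤m p 1)) λ { (() , _) })
      (on-column ‖i₁‖) (on-antidiagonal ‖i₁‖ ‖i₋₂‖ (trans (cong (_% p) 1+p∸2≡p∸1) (small p∸1<p))))
    (classify Z (λ _ z h → T-∨-introˡ (⟦ row₁ ⟧ z) h) (λ _ z h → T-∨-introʳ (⟦ row₁ ⟧ z) (T-∨-introˡ (⟦ column₁ ⟧ z) h))
      (λ _ z h → T-∨-introʳ (⟦ row₁ ⟧ z) (T-∨-introʳ (⟦ column₁ ⟧ z) h)))
    (p ∸ 3) (few-generics 3 (+-mono-≤ (count-present {R} r) (+-mono-≤ (count-present {C} c) (count-present {A} a)))))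
    where
    Z = ⟦ row₁ ⟧ ∪ ⟦ column₁ ⟧ ∪ ⟦ antidiagonal₋₁ ⟧
    sizes : # (S∖0 ∩ ⟦ row₁ ⟧) + # (S∖0 ∩ ⟦ column₁ ⟧) + # (S∖0 ∩ ⟦ antidiagonal₋₁ ⟧) ≡ 3 * p
    sizes = trans (sym (+-identityʳ _)) (three-sizes {# (S∖0 ∩ ⟦ row₁ ⟧)} {# (S∖0 ∩ ⟦ column₁ ⟧)} {# (S∖0 ∩ ⟦ antidiagonal₋₁ ⟧)} {0} {0} {0}
      (full-size row₁-size) (full-size column₁-size) (full-size antidiagonal₋₁-size))

  impossible : ⊥
  impossible with any? (T? ∘ R) L | any? (T? ∘ C) L | any? (T? ∘ A) L
  ... | no  ¬r | no  ¬c | no  ¬a = all-generic-case ¬r ¬c ¬a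
  ... | yes  r | no  ¬c | no  ¬a = rows-case r ¬c ¬a
  ... | no  ¬r | yes  c | no  ¬a = columns-case ¬r c ¬a
  ... | no  ¬r | no  ¬c | yes  a = antidiagonals-case ¬r ¬c a
  ... | yes  r | yes  c | no  ¬a = rows-columns-case r c ¬a
  ... | yes  r | no  ¬c | yes  a = rows-antidiagonals-case r ¬c a
  ... | no  ¬r | yes  c | yes  a = columns-antidiagonals-case ¬r c a
  ... | yes  r | yes  c | yes  a = all-directions-case r c a

proposition3p7 : (p : ℕ) .{{_ : NonZero p}} → Prime p → 5 ≤ p →
    (L : List (Line p)) →
    All (λ ℓ → ¬ (origin ∈L ℓ)) L →
    (∀ z → InS∖0 z → Any (λ ℓ → z ∈L ℓ) L) →
    p + 1 ≤ length L
proposition3p7 p@(suc _) p-prime 5≤p L avoids covers with p + 1 ≤? length L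
... | yes enough = enough
... | no  few    = ⊥-elim (Covering.impossible p p-prime 5≤p L (All.map (λ {ℓ} → c≢0 ℓ) avoids) covers
                     (m<1+n⇒m≤n (≤-trans (≰⇒> few) (≤-reflexive (+-comm p 1)))))
  where
  c≢0 : ∀ ℓ → ¬ (origin ∈L ℓ) → toℕ (Line.c ℓ) ≢ 0
  c≢0 ℓ ∉ℓ c≡0 = ∉ℓ (trans (cong (_% p) (cong₂ _+_ (*-zeroʳ (toℕ (Line.a ℓ))) (*-zeroʳ (toℕ (Line.b ℓ))))) (sym c≡0))
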